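{- Let $r \geq 0$ be an integer and let $s_{r}(z) = \sum_{n\geq 0} |S_{n,r}(321)|\, z^n$. Then the radius of convergence of $s_r(z)$ is $1/4$.
   Context: A permutation $p = p_1\cdots p_n$ contains a copy of the pattern $321$ at indices $a<b<c$ if $p_a > p_b > p_c$. $S_{n,r}(321)$ denotes the set of permutations of $\{1,\dots,n\}$ containing exactly $r$ copies of $321$ (i.e. exactly $r$ such index triples). -}

module Defs where

open import Data.Nat using (ℕ; zero; suc)
open import Data.Fin using (Fin; _<_; _<?_)
open import Data.Fin.Properties using (_≟_)
open import Data.Vec using (Vec; []; _∷_; lookup; toList)
open import Data.List using (List; [_]; concatMap; map; allFin; filter; length)
open import Data.List.Relation.Unary.Unique.Propositional using (Unique)
import Data.List.Relation.Unary.Unique.DecPropositional as UDec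
open import Data.Product using (_×_; _,_)
open import Relation.Nullary using (Dec)
open import Relation.Nullary.Decidable using (_×-dec_)
open import Relation.Binary.PropositionalEquality using (_≡_)
import Data.Nat as ℕ

-- A permutation p₁⋯pₙ of {1,…,n} is represented (0-based) as a word
-- v : Vec (Fin n) n with pairwise distinct entries (p_i = toℕ (lookup v i) + 1).

allWords : (n k : ℕ) → List (Vec (Fin n) k)
allWords n zero = [ [] ]
allWords n (suc k) = concatMap (λ i → map (i ∷_) (allWords n k)) (allFin n)

IsPerm : {n : ℕ} → Vec (Fin n) n → Set
IsPerm v = Unique (toList v)

isPerm? : {n : ℕ} → (v : Vec (Fin n) n) → Dec (IsPerm v)
isPerm? {n} v = UDec.unique? (_≟_ {n}) (toList v)

perms : (n : ℕ) → List (Vec (Fin n) n)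
perms n = filter isPerm? (allWords n n)

Occ321 : {n : ℕ} → Vec (Fin n) n → Fin n × Fin n × Fin n → Set
Occ321 v (a , b , c) = (a < b) × (b < c) × (lookup v b < lookup v a) × (lookup v c < lookup v b)

occ321? : {n : ℕ} → (v : Vec (Fin n) n) → (t : Fin n × Fin n × Fin n) → Dec (Occ321 v t)
occ321? v (a , b , c) = (a <? b) ×-dec ((b <? c) ×-dec ((lookup v b <? lookup v a) ×-dec (lookup v c <? lookup v b)))

triples : (n : ℕ) → List (Fin n × Fin n × Fin n)
triples n = concatMap (λ a → concatMap (λ b → map (λ c → a , b , c) (allFin n)) (allFin n)) (allFin n)

count321 : {n : ℕ} → Vec (Fin n) n → ℕ
count321 {n} v = length (filter (occ321? v) (triples n))

S : (n r : ℕ) → List (Vec (Fin n) n)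
S n r = filter (λ v → count321 v ℕ.≟ r) (perms n)

-- |S_{n,r}(321)|, the n-th coefficient of s_r(z)
s : (r n : ℕ) → ℕ
s r n = length (S n r)

-- Upper bound: a permutation is determined by the positions of its left-to-right maxima
-- and their set of values, the positions of the remaining right-to-left minima, and the
-- values at all other positions.  Each of these other positions is the middle entry of a
-- 321, so there are at most r of them and |S_{n,r}(321)| ≤ 4ⁿ (n + 1)^{2r}.
-- Lower bound: writing r + 1, r, 0, 1, …, r − 1 in front of a 321-avoiding permutation of
-- length m (shifted up by r + 2) gives exactly r copies of 321; 321-avoiding permutations are
-- built from ballot paths, so there are at least Catalan(m) ≥ 4ᵐ / ((m + 1)(2m + 1)) of them.
-- Polynomial factors are eventually absorbed by any larger exponential base.

module Submission where

open import Defs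
open import Data.Nat using (ℕ; _*_; _^_; _≤_; _<_)
open import Data.Product using (_×_; ∃-syntax)

open import Data.Empty using (⊥)
open import Data.Fin as Fin using (Fin; toℕ; punchOut)
open import Data.Fin.Induction using (<-wellFounded)
import Data.Fin.Properties as Finₚ
open import Data.List as List
  using (List; []; _∷_; _++_; _∷ʳ_; map; concatMap; filter; length; allFin; upTo; cartesianProduct)
open import Data.List.Membership.Propositional using (_∈_; _∉_; find)
open import Data.List.Membership.Propositional.Properties
open import Data.List.Properties
  using (length-map; length-++; length-removeAt′; length-tabulate; length-upTo; ∷ʳ-injective; ∷ʳ-injectiveˡ; ∷ʳ-injectiveʳ)
open import Data.List.Relation.Unary.All as All using (All; []; _∷_)
import Data.List.Relation.Unary.All.Properties as All
open import Data.List.Relation.Unary.AllPairs as AllPairs using (AllPairs)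
import Data.List.Relation.Unary.AllPairs.Properties as AllPairs
open import Data.List.Relation.Unary.Any as Any using (here; there; _─_)
open import Data.List.Relation.Unary.Unique.Propositional using (Unique; []; _∷_)
import Data.List.Relation.Unary.Unique.Propositional.Properties as Unique
open import Data.Nat
open import Data.Nat.DivMod using (_mod_; m<n⇒m%n≡m)
open import Data.Nat.Properties
open import Algebra.Properties.CommutativeSemigroup *-commutativeSemigroup using (interchange)
open import Data.Nat.Tactic.RingSolver using (solve-∀)
open import Data.Product using (_,_; proj₁; proj₂)
open import Data.Sum using (_⊎_; inj₁; inj₂)
open import Data.Unit using (⊤; tt)
open import Data.Vec as Vec using (Vec; []; _∷_; lookup; toList; tabulate)
import Data.Vec.Membership.Propositional.Properties as Vecₚ
open import Data.Vec.Properties using (lookup∘tabulate; tabulate∘lookup; tabulate-cong)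
open import Function using (id; _∘_)
open import Induction.WellFounded using (Acc; acc)
open import Relation.Binary using (tri<; tri≈; tri>)
open import Relation.Binary.PropositionalEquality
open import Relation.Nullary using (¬_; Dec; yes; no; contradiction)
open import Relation.Nullary.Decidable using (_×-dec_; _→-dec_)

-- Binomial coefficients and exponential growth

^-distribʳ-* : ∀ m n o → (m * n) ^ o ≡ m ^ o * n ^ o
^-distribʳ-* m n zero    = refl
^-distribʳ-* m n (suc o) =
  trans (cong (m * n *_) (^-distribʳ-* m n o)) (interchange m n (m ^ o) (n ^ o))

-- Pascal's rule holds by definition, unlike for Data.Nat.Combinatorics._C_.
infix 8 _choose_
_choose_ : ℕ → ℕ → ℕ
n     choose zero  = 1
zero  choose suc k = 0
suc n choose suc k = n choose k + n choose suc k

choose-1 : ∀ n → n choose 1 ≡ n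
choose-1 zero    = refl
choose-1 (suc n) = cong suc (choose-1 n)

choose-2 : ∀ n → 2 * n choose 2 + n ≡ n * n
choose-2 zero    = refl
choose-2 (suc n) = begin
  2 * (n choose 1 + n choose 2) + suc n ≡⟨ cong (λ c → 2 * (c + n choose 2) + suc n) (choose-1 n) ⟩
  2 * (n + n choose 2) + suc n          ≡⟨ regroup n (n choose 2) ⟩
  (2 * n choose 2 + n) + (2 * n + 1)    ≡⟨ cong (_+ (2 * n + 1)) (choose-2 n) ⟩
  n * n + (2 * n + 1)                   ≡⟨ square n ⟩
  suc n * suc n                         ∎
  where
  open ≡-Reasoning
  regroup : ∀ n c → 2 * (n + c) + suc n ≡ (2 * c + n) + (2 * n + 1)
  regroup = solve-∀
  square : ∀ n → n * n + (2 * n + 1) ≡ suc n * suc n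
  square = solve-∀

choose-absorb : ∀ m k → suc k * suc m choose suc k ≡ suc m * m choose k
choose-absorb zero    zero    = refl
choose-absorb zero    (suc k) = *-zeroʳ (2 + k)
choose-absorb (suc m) zero    = trans (+-identityʳ _) (trans (choose-1 (2 + m)) (sym (*-identityʳ _)))
choose-absorb (suc m) (suc k) = begin
  (2 + k) * ((X + Y) + Z)                     ≡⟨ expand k X Y Z ⟩
  (X + Y) + ((1 + k) * (X + Y) + (2 + k) * Z)
    ≡⟨ cong₂ (λ u v → (X + Y) + (u + v)) (choose-absorb m k) (choose-absorb m (suc k)) ⟩
  (X + Y) + ((1 + m) * X + (1 + m) * Y)       ≡⟨ collect m X Y ⟩
  (2 + m) * (X + Y)                           ∎
  where
  open ≡-Reasoning
  X = m choose k
  Y = m choose suc k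
  Z = suc m choose suc (suc k)
  expand : ∀ k X Y Z → (2 + k) * ((X + Y) + Z) ≡ (X + Y) + ((1 + k) * (X + Y) + (2 + k) * Z)
  expand = solve-∀
  collect : ∀ m X Y → (X + Y) + ((1 + m) * X + (1 + m) * Y) ≡ (2 + m) * (X + Y)
  collect = solve-∀

choose-ratio : ∀ k j → suc k * (k + j) choose suc k ≡ j * (k + j) choose k
choose-ratio k j = +-cancelˡ-≡ (suc k * A) _ _ (begin
  suc k * A + suc k * B ≡⟨ *-distribˡ-+ (suc k) A B ⟨
  suc k * (A + B)       ≡⟨ choose-absorb (k + j) k ⟩
  suc (k + j) * A       ≡⟨ *-distribʳ-+ A (suc k) j ⟩
  suc k * A + j * A     ∎)
  where
  open ≡-Reasoning
  A = (k + j) choose k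
  B = (k + j) choose suc k

choose-middle-symmetric : ∀ k → suc (k + k) choose k ≡ suc (k + k) choose suc k
choose-middle-symmetric k = sym (*-cancelˡ-≡ _ _ (suc k)
  (subst (λ m → suc k * m choose suc k ≡ suc k * m choose k) (+-suc k k) (choose-ratio k (suc k))))

central-choose-step : ∀ n → suc n * (2 + n + n) choose suc n ≡ 2 * suc (n + n) * (n + n) choose n
central-choose-step n = *-cancelˡ-≡ _ _ (suc n) (begin
  suc n * (suc n * (2 + n + n) choose suc n)            ≡⟨ cong (suc n *_) (choose-absorb (suc (n + n)) n) ⟩
  suc n * ((2 + n + n) * suc (n + n) choose n)
    ≡⟨ cong (λ c → suc n * ((2 + n + n) * c)) (choose-middle-symmetric n) ⟩
  suc n * ((2 + n + n) * C)                             ≡⟨ swap (suc n) (2 + n + n) C ⟩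
  (2 + n + n) * (suc n * C)                             ≡⟨ cong ((2 + n + n) *_) (choose-absorb (n + n) n) ⟩
  (2 + n + n) * (suc (n + n) * (n + n) choose n)        ≡⟨ factor n ((n + n) choose n) ⟩
  suc n * (2 * suc (n + n) * (n + n) choose n)          ∎)
  where
  open ≡-Reasoning
  C = suc (n + n) choose suc n
  swap : ∀ a b c → a * (b * c) ≡ b * (a * c)
  swap = solve-∀
  factor : ∀ n c → (2 + n + n) * (suc (n + n) * c) ≡ suc n * (2 * suc (n + n) * c)
  factor = solve-∀

4^n≤[1+2n]*central-binomial : ∀ n → 4 ^ n ≤ suc (n + n) * (n + n) choose n
4^n≤[1+2n]*central-binomial zero    = ≤-refl
4^n≤[1+2n]*central-binomial (suc n) = *-cancelˡ-≤ (suc n) (begin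
  suc n * (4 * 4 ^ n)                       ≡⟨ *-assoc (suc n) 4 (4 ^ n) ⟨
  suc n * 4 * 4 ^ n                         ≤⟨ *-monoʳ-≤ (suc n * 4) (4^n≤[1+2n]*central-binomial n) ⟩
  suc n * 4 * (suc (n + n) * C)             ≤⟨ *-monoˡ-≤ (suc (n + n) * C) (m≤n+m (suc n * 4) 2) ⟩
  (2 + suc n * 4) * (suc (n + n) * C)       ≡⟨ regroup n C ⟩
  (3 + n + n) * (2 * suc (n + n) * C)       ≡⟨ cong ((3 + n + n) *_) (central-choose-step n) ⟨
  (3 + n + n) * (suc n * C′)                ≡⟨ swap (3 + n + n) (suc n) C′ ⟩
  suc n * ((3 + n + n) * C′)                ≡⟨ cong (λ m → suc n * (suc m * m choose suc n)) (+-suc (suc n) n) ⟨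
  suc n * (suc (suc n + suc n) * (suc n + suc n) choose suc n) ∎)
  where
  open ≤-Reasoning
  C  = (n + n) choose n
  C′ = (2 + n + n) choose suc n
  regroup : ∀ n c → (2 + suc n * 4) * (suc (n + n) * c) ≡ (3 + n + n) * (2 * suc (n + n) * c)
  regroup = solve-∀
  swap : ∀ a b c → a * (b * c) ≡ b * (a * c)
  swap = solve-∀

binomial-term≤ : ∀ b n j → n choose j * b ^ n ≤ suc b ^ n * b ^ j
binomial-term≤ b zero    zero    = ≤-refl
binomial-term≤ b zero    (suc j) = z≤n
binomial-term≤ b (suc n) zero    = begin
  1 * (b * b ^ n) ≡⟨ *-identityˡ _ ⟩
  b ^ suc n       ≤⟨ ^-monoˡ-≤ (suc n) (n≤1+n b) ⟩
  suc b ^ suc n   ≡⟨ *-identityʳ _ ⟨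
  suc b ^ suc n * 1 ∎
  where open ≤-Reasoning
binomial-term≤ b (suc n) (suc j) = begin
  (n choose j + n choose suc j) * (b * b ^ n)             ≡⟨ distrib (n choose j) (n choose suc j) b (b ^ n) ⟩
  b * (n choose j * b ^ n) + b * (n choose suc j * b ^ n)
    ≤⟨ +-mono-≤ (*-monoʳ-≤ b (binomial-term≤ b n j)) (*-monoʳ-≤ b (binomial-term≤ b n (suc j))) ⟩
  b * (P * b ^ j) + b * (P * (b * b ^ j))                 ≡⟨ collect b P (b ^ j) ⟩
  suc b * P * (b * b ^ j)                                 ∎
  where
  open ≤-Reasoning
  P = suc b ^ n
  distrib : ∀ x y b c → (x + y) * (b * c) ≡ b * (x * c) + b * (y * c)
  distrib = solve-∀
  collect : ∀ b P Q → b * (P * Q) + b * (P * (b * Q)) ≡ suc b * P * (b * Q)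
  collect = solve-∀

Eventually : (ℕ → Set) → Set
Eventually P = ∃[ N ] (∀ n → N ≤ n → P n)

eventually-× : ∀ {P Q : ℕ → Set} → Eventually P → Eventually Q → Eventually (λ n → P n × Q n)
eventually-× (M , p) (N , q) =
  M + N , λ n M+N≤n → p n (≤-trans (m≤m+n M N) M+N≤n) , q n (≤-trans (m≤n+m N M) M+N≤n)

linear≤square : ∀ B n → 3 + 4 * B ≤ n → 2 * B * suc n + n ≤ n * n
linear≤square B zero    ()
linear≤square B (suc n) N≤n = begin
  2 * B * (2 + n) + suc n                        ≤⟨ m≤m+n _ (2 * B * n + 2 * n + 2) ⟩
  2 * B * (2 + n) + suc n + (2 * B * n + 2 * n + 2)  ≡⟨ expand B n ⟩
  (3 + 4 * B) * suc n                            ≤⟨ *-monoˡ-≤ (suc n) N≤n ⟩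
  suc n * suc n                                  ∎
  where
  open ≤-Reasoning
  expand : ∀ B n → 2 * B * (2 + n) + suc n + (2 * B * n + 2 * n + 2) ≡ (3 + 4 * B) * suc n
  expand = solve-∀

-- The quadratic term of the binomial expansion of (1 + b)ⁿ already beats bⁿ (n + 1).
exponential-dominates-linear : ∀ b → Eventually (λ n → b ^ n * suc n ≤ suc b ^ n)
exponential-dominates-linear zero    = 1 , λ { (suc n) _ → z≤n }
exponential-dominates-linear (suc b) = 3 + 4 * B , bound
  where
  B = suc b * suc b
  bound : ∀ n → 3 + 4 * B ≤ n → suc b ^ n * suc n ≤ suc (suc b) ^ n
  bound n N≤n = *-cancelˡ-≤ (2 * B) (begin
    2 * B * (suc b ^ n * suc n)         ≡⟨ swap (2 * B) (suc b ^ n) (suc n) ⟩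
    2 * B * suc n * suc b ^ n           ≤⟨ *-monoˡ-≤ (suc b ^ n) linear≤choose-2 ⟩
    2 * n choose 2 * suc b ^ n          ≡⟨ *-assoc 2 (n choose 2) (suc b ^ n) ⟩
    2 * (n choose 2 * suc b ^ n)        ≤⟨ *-monoʳ-≤ 2 (binomial-term≤ (suc b) n 2) ⟩
    2 * (suc (suc b) ^ n * suc b ^ 2)   ≡⟨ regroup (suc (suc b) ^ n) (suc b) ⟩
    2 * B * suc (suc b) ^ n             ∎)
    where
    open ≤-Reasoning
    linear≤choose-2 : 2 * B * suc n ≤ 2 * n choose 2
    linear≤choose-2 = +-cancelʳ-≤ n _ _
      (subst (2 * B * suc n + n ≤_) (sym (choose-2 n)) (linear≤square B n N≤n))
    swap : ∀ a x y → a * (x * y) ≡ a * y * x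
    swap = solve-∀
    regroup : ∀ P c → 2 * (P * (c * (c * 1))) ≡ 2 * (c * c) * P
    regroup = solve-∀

-- Induction on k, comparing the bases 2b < 2b + 1 < 2b + 2.
exponential-dominates-polynomial : ∀ k b → Eventually (λ n → b ^ n * suc n ^ k ≤ suc b ^ n)
exponential-dominates-polynomial zero    b = 0 , λ n _ →
  ≤-trans (≤-reflexive (*-identityʳ (b ^ n))) (^-monoˡ-≤ n (n≤1+n b))
exponential-dominates-polynomial (suc k) b
  with N , bounds ← eventually-× (exponential-dominates-linear (2 * b))
                                 (exponential-dominates-polynomial k (suc (2 * b)))
  = N , λ n N≤n → let linear , poly = bounds n N≤n in
  *-cancelˡ-≤ (2 ^ n) {{m^n≢0 2 n}} (begin
    2 ^ n * (b ^ n * suc n ^ suc k)           ≡⟨ regroup (2 ^ n) (b ^ n) (suc n) (suc n ^ k) ⟩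
    2 ^ n * b ^ n * suc n * suc n ^ k         ≡⟨ cong (λ x → x * suc n * suc n ^ k) (^-distribʳ-* 2 b n) ⟨
    (2 * b) ^ n * suc n * suc n ^ k           ≤⟨ *-monoˡ-≤ (suc n ^ k) linear ⟩
    suc (2 * b) ^ n * suc n ^ k               ≤⟨ poly ⟩
    suc (suc (2 * b)) ^ n                     ≡⟨ cong (_^ n) (*-suc 2 b) ⟨
    (2 * suc b) ^ n                           ≡⟨ ^-distribʳ-* 2 (suc b) n ⟩
    2 ^ n * suc b ^ n                         ∎)
  where
  open ≤-Reasoning
  regroup : ∀ t x y z → t * (x * (y * z)) ≡ t * x * y * z
  regroup = solve-∀

-- Counting lists by injections

∈-─⁺ : ∀ {A : Set} {x y : A} {xs} (p : x ∈ xs) → y ∈ xs → y ≢ x → y ∈ (xs ─ p)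
∈-─⁺ (here refl) (here refl) y≢x = contradiction refl y≢x
∈-─⁺ (here refl) (there q)   _   = q
∈-─⁺ (there p)   (here refl) _   = here refl
∈-─⁺ (there p)   (there q)   y≢x = there (∈-─⁺ p q y≢x)

module _ {A B : Set} where

  length-≤-by-injection : (R : A → B → Set) {xs : List A} {ys : List B} → Unique xs →
    (∀ {x} → x ∈ xs → ∃[ y ] (y ∈ ys × R x y)) →
    (∀ {x x′ y} → x ∈ xs → x′ ∈ xs → R x y → R x′ y → x ≡ x′) →
    length xs ≤ length ys
  length-≤-by-injection R {[]}     _          _     _   = z≤n
  length-≤-by-injection R {x ∷ xs} {ys} (x∉xs ∷ xs!) image inj
    with y , y∈ys , Rxy ← image (here refl) = begin
      suc (length xs)          ≤⟨ s≤s (length-≤-by-injection R xs! image′ (λ p q → inj (there p) (there q))) ⟩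
      suc (length (ys ─ y∈ys)) ≡⟨ length-removeAt′ ys (Any.index y∈ys) ⟨
      length ys                ∎
    where
    open ≤-Reasoning
    image′ : ∀ {x′} → x′ ∈ xs → ∃[ y′ ] (y′ ∈ (ys ─ y∈ys) × R x′ y′)
    image′ x′∈xs with y′ , y′∈ys , Rx′y′ ← image (there x′∈xs) =
      y′ , ∈-─⁺ y∈ys y′∈ys (λ { refl → All.lookup x∉xs x′∈xs (inj (here refl) (there x′∈xs) Rxy Rx′y′) }) ,
      Rx′y′

  length-≤-by-injectiveMap : (f : A → B) {xs : List A} {ys : List B} → Unique xs →
    (∀ {x} → x ∈ xs → f x ∈ ys) →
    (∀ {x x′} → x ∈ xs → x′ ∈ xs → f x ≡ f x′ → x ≡ x′) →
    length xs ≤ length ys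
  length-≤-by-injectiveMap f xs! image inj =
    length-≤-by-injection (λ x y → f x ≡ y) xs! (λ x∈xs → _ , image x∈xs , refl)
      (λ x∈xs x′∈xs fx≡y fx′≡y → inj x∈xs x′∈xs (trans fx≡y (sym fx′≡y)))

  ∈-concatMap⁺′ : ∀ {f : A → List B} {x y xs} → x ∈ xs → y ∈ f x → y ∈ concatMap f xs
  ∈-concatMap⁺′ {f} x∈xs y∈fx = ∈-concatMap⁺ f (Any.map (λ { refl → y∈fx }) x∈xs)

  Unique-concatMap⁺ : (f : A → List B) (tag : B → A) {xs : List A} → Unique xs →
    (∀ x → Unique (f x)) → (∀ x {y} → y ∈ f x → tag y ≡ x) → Unique (concatMap f xs)
  Unique-concatMap⁺ f tag {[]}     _           _  _       = []
  Unique-concatMap⁺ f tag {x ∷ xs} (x∉xs ∷ xs!) f! tagged =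
    Unique.++⁺ (f! x) (Unique-concatMap⁺ f tag xs! f! tagged) disjoint
    where
    disjoint : ∀ {y} → ¬ (y ∈ f x × y ∈ concatMap f xs)
    disjoint (y∈fx , y∈rest) with x′ , x′∈xs , y∈fx′ ← find (∈-concatMap⁻ f {xs = xs} y∈rest) =
      All.lookup x∉xs x′∈xs (trans (sym (tagged x y∈fx)) (tagged x′ y∈fx′))

  length-concatMap-const : (f : A → List B) {c : ℕ} (xs : List A) →
    (∀ x → length (f x) ≡ c) → length (concatMap f xs) ≡ length xs * c
  length-concatMap-const f []       _    = refl
  length-concatMap-const f (x ∷ xs) same =
    trans (length-++ (f x)) (cong₂ _+_ (same x) (length-concatMap-const f xs same))

Unique-map⁺ : ∀ {A B : Set} (f : A → B) {xs} → (∀ {x y} → x ∈ xs → y ∈ xs → f x ≡ f y → x ≡ y) →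
  Unique xs → Unique (map f xs)
Unique-map⁺ f {[]}     _   _            = Unique.[]
Unique-map⁺ f {x ∷ xs} inj (x∉xs Unique.∷ xs!) =
  All.map⁺ (All.tabulate (λ y∈xs fx≡fy → All.lookup x∉xs y∈xs (inj (here refl) (there y∈xs) fx≡fy)))
  Unique.∷ Unique-map⁺ f (λ x∈ y∈ → inj (there x∈) (there y∈)) xs!

length-cartesianProduct : ∀ {A B : Set} (xs : List A) (ys : List B) →
  length (cartesianProduct xs ys) ≡ length xs * length ys
length-cartesianProduct []       ys = refl
length-cartesianProduct (x ∷ xs) ys =
  trans (length-++ (map (x ,_) ys)) (cong₂ _+_ (length-map (x ,_) ys) (length-cartesianProduct xs ys))

toList-tabulate : ∀ {A : Set} {k} (f : Fin k → A) → toList (tabulate f) ≡ List.tabulate f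
toList-tabulate {k = zero}  f = refl
toList-tabulate {k = suc k} f = cong (f Fin.zero ∷_) (toList-tabulate (f ∘ Fin.suc))

Unique-allWords : ∀ n k → Unique (allWords n k)
Unique-allWords n zero    = [] ∷ []
Unique-allWords n (suc k) =
  Unique-concatMap⁺ (λ i → map (i ∷_) (allWords n k)) Vec.head (Unique.allFin⁺ n)
    (λ i → Unique.map⁺ (λ { refl → refl }) (Unique-allWords n k)) tagged
  where
  tagged : ∀ i {w} → w ∈ map (i ∷_) (allWords n k) → Vec.head w ≡ i
  tagged i w∈ with _ , _ , refl ← ∈-map⁻ (i ∷_) w∈ = refl

∈-allWords : ∀ n {k} (w : Vec (Fin n) k) → w ∈ allWords n k
∈-allWords n []      = here refl
∈-allWords n (i ∷ w) = ∈-concatMap⁺′ (∈-allFin i) (∈-map⁺ (i ∷_) (∈-allWords n w))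

length-allWords : ∀ n k → length (allWords n k) ≡ n ^ k
length-allWords n zero    = refl
length-allWords n (suc k) =
  trans (length-concatMap-const _ (allFin n) (λ i → trans (length-map (i ∷_) (allWords n k)) (length-allWords n k)))
        (cong (_* n ^ k) (length-tabulate {n = n} id))

Unique-triples : ∀ n → Unique (triples n)
Unique-triples n =
  Unique-concatMap⁺ fixFirst proj₁ (Unique.allFin⁺ n) Unique-fixFirst fixFirst-tagged
  where
  fixTwo : Fin n → Fin n → List (Fin n × Fin n × Fin n)
  fixTwo a b = map (λ c → a , b , c) (allFin n)
  fixFirst : Fin n → List (Fin n × Fin n × Fin n)
  fixFirst a = concatMap (fixTwo a) (allFin n)
  fixTwo-tagged : ∀ a b {t} → t ∈ fixTwo a b → proj₁ (proj₂ t) ≡ b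
  fixTwo-tagged a b t∈ with _ , _ , refl ← ∈-map⁻ (λ c → a , b , c) t∈ = refl
  Unique-fixFirst : ∀ a → Unique (fixFirst a)
  Unique-fixFirst a = Unique-concatMap⁺ (fixTwo a) (λ t → proj₁ (proj₂ t)) (Unique.allFin⁺ n)
    (λ b → Unique.map⁺ (λ { refl → refl }) (Unique.allFin⁺ n)) (fixTwo-tagged a)
  fixFirst-tagged : ∀ a {t} → t ∈ fixFirst a → proj₁ t ≡ a
  fixFirst-tagged a t∈ with b , _ , t∈′ ← find (∈-concatMap⁻ (fixTwo a) {xs = allFin n} t∈)
                       with _ , _ , refl ← ∈-map⁻ (λ c → a , b , c) t∈′ = refl

∈-triples : ∀ {n} (a b c : Fin n) → (a , b , c) ∈ triples n
∈-triples a b c =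
  ∈-concatMap⁺′ (∈-allFin a) (∈-concatMap⁺′ (∈-allFin b) (∈-map⁺ (λ c → a , b , c) (∈-allFin c)))

Unique-S : ∀ n r → Unique (S n r)
Unique-S n r = Unique.filter⁺ _ (Unique.filter⁺ _ (Unique-allWords n n))

∈-S⁻ : ∀ {n r v} → v ∈ S n r → IsPerm v × count321 v ≡ r
∈-S⁻ {n} {r} v∈ with v∈perms , count≡r ← ∈-filter⁻ (λ v → count321 v ≟ r) {xs = perms n} v∈ =
  proj₂ (∈-filter⁻ isPerm? {xs = allWords n n} v∈perms) , count≡r

∈-S⁺ : ∀ {n r} (v : Vec (Fin n) n) → IsPerm v → count321 v ≡ r → v ∈ S n r
∈-S⁺ {n} {r} v v-perm count≡r =
  ∈-filter⁺ (λ v → count321 v ≟ r) (∈-filter⁺ isPerm? (∈-allWords n v) v-perm) count≡r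

-- The upper bound: encoding a permutation by its records

lookup-injective : ∀ {A : Set} {k} (xs : Vec A k) → Unique (toList xs) →
  ∀ {i j} → lookup xs i ≡ lookup xs j → i ≡ j
lookup-injective (x ∷ xs) _ {Fin.zero} {Fin.zero} _ = refl
lookup-injective (x ∷ xs) (x∉xs ∷ _) {Fin.zero} {Fin.suc j} x≡xⱼ =
  contradiction x≡xⱼ (All.lookup x∉xs (Vecₚ.∈-toList⁺ (Vecₚ.∈-lookup j xs)))
lookup-injective (x ∷ xs) (x∉xs ∷ _) {Fin.suc i} {Fin.zero} xᵢ≡x =
  contradiction (sym xᵢ≡x) (All.lookup x∉xs (Vecₚ.∈-toList⁺ (Vecₚ.∈-lookup i xs)))
lookup-injective (x ∷ xs) (_ ∷ xs!) {Fin.suc i} {Fin.suc j} xᵢ≡xⱼ =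
  cong Fin.suc (lookup-injective xs xs! xᵢ≡xⱼ)

injective⇒surjective : ∀ {n} (f : Fin n → Fin n) → (∀ {i j} → f i ≡ f j → i ≡ j) →
  ∀ y → ∃[ i ] (f i ≡ y)
injective⇒surjective {zero}  f inj ()
injective⇒surjective {suc n} f inj y with Finₚ.any? (λ i → f i Finₚ.≟ y)
... | yes hit = hit
... | no miss =
  let i , j , i<j , pᵢ≡pⱼ = Finₚ.pigeonhole (n<1+n n) (λ i → punchOut (missed i)) in
  contradiction (inj (Finₚ.punchOut-injective (missed i) (missed j) pᵢ≡pⱼ)) (Finₚ.<⇒≢ i<j)
  where
  missed : ∀ i → y ≢ f i
  missed i y≡fi = miss (i , sym y≡fi)

module _ {n m : ℕ} {P : Fin n → Set} where

  private
    Increasing : (Fin n → Fin m) → Set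
    Increasing f = ∀ {i j} → P i → P j → i Fin.< j → f i Fin.< f j

    ImageWithin : (Fin n → Fin m) → (Fin n → Fin m) → Set
    ImageWithin f g = ∀ {i} → P i → ∃[ j ] (P j × g j ≡ f i)

    -- If f and g agree on P below i, the value f i is taken by g at some j ≥ i.
    ≤-from-agreement-below : ∀ {f g} → Increasing f → Increasing g → ImageWithin f g →
      ∀ {i} → P i → (∀ {j} → j Fin.< i → P j → f j ≡ g j) → g i Fin.≤ f i
    ≤-from-agreement-below {f} {g} f↑ g↑ f⊆g {i} Pi agree
      with j , Pj , gⱼ≡fᵢ ← f⊆g Pi with Finₚ.<-cmp j i
    ... | tri< j<i _ _ = contradiction (trans (agree j<i Pj) gⱼ≡fᵢ) (Finₚ.<⇒≢ (f↑ Pj Pi j<i))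
    ... | tri≈ _ refl _ = Finₚ.≤-reflexive gⱼ≡fᵢ
    ... | tri> _ _ i<j = <⇒≤ (subst (g i Fin.<_) gⱼ≡fᵢ (g↑ Pi Pj i<j))

  increasing-same-image⇒≡ : ∀ {f g} → Increasing f → Increasing g →
    ImageWithin f g → ImageWithin g f → ∀ {i} → P i → f i ≡ g i
  increasing-same-image⇒≡ {f} {g} f↑ g↑ f⊆g g⊆f {i} = go (<-wellFounded i)
    where
    go : ∀ {i} → Acc Fin._<_ i → P i → f i ≡ g i
    go (acc below) Pi = Finₚ.≤-antisym
      (≤-from-agreement-below g↑ f↑ g⊆f Pi (λ j<i Pj → sym (go (below j<i) Pj)))
      (≤-from-agreement-below f↑ g↑ f⊆g Pi (λ j<i Pj → go (below j<i) Pj))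

data Label (n : ℕ) : Set where
  lrMax rlMin : Label n
  middle      : Fin n → Label n

module _ {n : ℕ} (v : Vec (Fin n) n) where

  IsLRMax IsRLMin : Fin n → Set
  IsLRMax i = ∀ j → j Fin.< i → lookup v j Fin.< lookup v i
  IsRLMin i = ∀ j → i Fin.< j → lookup v i Fin.< lookup v j

  isLRMax? : ∀ i → Dec (IsLRMax i)
  isLRMax? i = Finₚ.all? (λ j → (j Finₚ.<? i) →-dec (lookup v j Finₚ.<? lookup v i))

  isRLMin? : ∀ i → Dec (IsRLMin i)
  isRLMin? i = Finₚ.all? (λ j → (i Finₚ.<? j) →-dec (lookup v i Finₚ.<? lookup v j))

  -- A position that is neither kind of record is the middle of a 321; its value is stored.
  label : Fin n → Label n
  label i with isLRMax? i | isRLMin? i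
  ... | yes _ | _     = lrMax
  ... | no _  | yes _ = rlMin
  ... | no _  | no _  = middle (lookup v i)

  label-lrMax⁻ : ∀ {i} → label i ≡ lrMax → IsLRMax i
  label-lrMax⁻ {i} eq with isLRMax? i | isRLMin? i
  ... | yes max | _ = max
  label-lrMax⁻ () | no _ | yes _
  label-lrMax⁻ () | no _ | no _

  label-lrMax⁺ : ∀ {i} → IsLRMax i → label i ≡ lrMax
  label-lrMax⁺ {i} max with isLRMax? i
  ... | yes _    = refl
  ... | no ¬max  = contradiction max ¬max

  label-rlMin⁻ : ∀ {i} → label i ≡ rlMin → IsRLMin i
  label-rlMin⁻ {i} eq with isLRMax? i | isRLMin? i
  label-rlMin⁻ () | yes _ | _
  ... | no _ | yes min = min
  label-rlMin⁻ () | no _ | no _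

  label-middle⁻ : ∀ {i y} → label i ≡ middle y → ¬ IsLRMax i × ¬ IsRLMin i × lookup v i ≡ y
  label-middle⁻ {i} eq with isLRMax? i | isRLMin? i
  label-middle⁻ () | yes _ | _
  label-middle⁻ () | no _ | yes _
  label-middle⁻ refl | no ¬max | no ¬min = ¬max , ¬min , refl

  maxValueBit : Fin n → Fin 2
  maxValueBit y with Finₚ.any? (λ i → (lookup v i Finₚ.≟ y) ×-dec isLRMax? i)
  ... | yes _ = Fin.suc Fin.zero
  ... | no _  = Fin.zero

  maxValueBit⁻ : ∀ {y} → maxValueBit y ≡ Fin.suc Fin.zero → ∃[ i ] (lookup v i ≡ y × IsLRMax i)
  maxValueBit⁻ {y} eq with Finₚ.any? (λ i → (lookup v i Finₚ.≟ y) ×-dec isLRMax? i)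
  ... | yes found = found
  maxValueBit⁻ () | no _

  maxValueBit⁺ : ∀ {i} → IsLRMax i → maxValueBit (lookup v i) ≡ Fin.suc Fin.zero
  maxValueBit⁺ {i} max with Finₚ.any? (λ j → (lookup v j Finₚ.≟ lookup v i) ×-dec isLRMax? j)
  ... | yes _       = refl
  ... | no notFound = contradiction (i , refl , max) notFound

  encode : Vec (Label n) n × Vec (Fin 2) n
  encode = tabulate label , tabulate maxValueBit

SameCode : ∀ {n} → Vec (Fin n) n → Vec (Fin n) n → Set
SameCode v w = (∀ i → label v i ≡ label w i) × (∀ y → maxValueBit v y ≡ maxValueBit w y)

SameCode-sym : ∀ {n} {v w : Vec (Fin n) n} → SameCode v w → SameCode w v
SameCode-sym (same-label , same-bit) = (λ i → sym (same-label i)) , (λ y → sym (same-bit y))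

encode-≡⇒SameCode : ∀ {n} {v w : Vec (Fin n) n} → encode v ≡ encode w → SameCode v w
encode-≡⇒SameCode {v = v} {w} eq =
  lookups (label v) (label w) (cong proj₁ eq) , lookups (maxValueBit v) (maxValueBit w) (cong proj₂ eq)
  where
  lookups : ∀ {A : Set} {k} (f g : Fin k → A) → tabulate f ≡ tabulate g → ∀ i → f i ≡ g i
  lookups f g eq i = trans (sym (lookup∘tabulate f i)) (trans (cong (λ xs → lookup xs i) eq) (lookup∘tabulate g i))

module _ {n : ℕ} (c : Label n) where

  ClassIncreasing ClassImage : Set
  ClassIncreasing = ∀ u {i j} → label u i ≡ c → label u j ≡ c → i Fin.< j → lookup u i Fin.< lookup u j
  ClassImage = ∀ {u u′} → IsPerm u → IsPerm u′ → SameCode u u′ →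
    ∀ {i} → label u i ≡ c → ∃[ j ] (label u′ j ≡ c × lookup u′ j ≡ lookup u i)

  same-class⇒≡ : ClassIncreasing → ClassImage → ∀ {v w} → IsPerm v → IsPerm w → SameCode v w →
    ∀ {i} → label v i ≡ c → lookup v i ≡ lookup w i
  same-class⇒≡ increasing image {v} {w} v-perm w-perm same@(same-label , _) =
    increasing-same-image⇒≡ (increasing v) (λ Pi Pj → increasing w (toW Pi) (toW Pj))
      (λ Pi → let j , Pj , wⱼ≡vᵢ = image v-perm w-perm same Pi in j , toV Pj , wⱼ≡vᵢ)
      (λ Pi → image w-perm v-perm (SameCode-sym same) (toW Pi))
    where
    toW : ∀ {j} → label v j ≡ c → label w j ≡ c
    toW {j} = trans (sym (same-label j))
    toV : ∀ {j} → label w j ≡ c → label v j ≡ c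
    toV {j} = trans (same-label j)

lrMax-increasing : ∀ {n} → ClassIncreasing {n} lrMax
lrMax-increasing u _ j-max i<j = label-lrMax⁻ u j-max _ i<j

rlMin-increasing : ∀ {n} → ClassIncreasing {n} rlMin
rlMin-increasing u i-min _ i<j = label-rlMin⁻ u i-min _ i<j

lrMax-image : ∀ {n} → ClassImage {n} lrMax
lrMax-image {u = u} {u′} _ _ (same-label , same-bit) {i} i-max
  with j , u′ⱼ≡uᵢ , j-max ← maxValueBit⁻ u′
         (trans (sym (same-bit (lookup u i))) (maxValueBit⁺ u (label-lrMax⁻ u i-max)))
  = j , label-lrMax⁺ u′ j-max , u′ⱼ≡uᵢ

module _ {n : ℕ} {u u′ : Vec (Fin n) n} (u-perm : IsPerm u) (same : SameCode u u′) where

  lrMax-value : ∀ {i j} → label u′ j ≡ lrMax → lookup u′ j ≡ lookup u i → label u i ≡ lrMax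
  lrMax-value {i} {j} j-max u′ⱼ≡uᵢ
    with i′ , uᵢ′≡uᵢ , i′-max ← maxValueBit⁻ u (trans (proj₂ same _)
           (trans (cong (maxValueBit u′) (sym u′ⱼ≡uᵢ)) (maxValueBit⁺ u′ (label-lrMax⁻ u′ j-max))))
    with refl ← lookup-injective u u-perm uᵢ′≡uᵢ = label-lrMax⁺ u i′-max

  middle-value : ∀ {i j y} → label u′ j ≡ middle y → lookup u′ j ≡ lookup u i → label u i ≡ middle y
  middle-value {i} {j} j-mid u′ⱼ≡uᵢ
    with refl ← lookup-injective u u-perm
                  (trans (proj₂ (proj₂ (label-middle⁻ u (trans (proj₁ same j) j-mid))))
                         (trans (sym (proj₂ (proj₂ (label-middle⁻ u′ j-mid)))) u′ⱼ≡uᵢ))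
    = trans (proj₁ same j) j-mid

rlMin-image : ∀ {n} → ClassImage {n} rlMin
rlMin-image {u = u} {u′} u-perm u′-perm same {i} i-min
  with j , u′ⱼ≡uᵢ ← injective⇒surjective (lookup u′) (lookup-injective u′ u′-perm) (lookup u i)
  = j , j-min , u′ⱼ≡uᵢ
  where
  j-min : label u′ j ≡ rlMin
  j-min with label u′ j in j-label
  ... | rlMin    = refl
  ... | lrMax    = contradiction (trans (sym i-min) (lrMax-value u-perm same j-label u′ⱼ≡uᵢ)) λ ()
  ... | middle _ = contradiction (trans (sym i-min) (middle-value u-perm same j-label u′ⱼ≡uᵢ)) λ ()

encode-injective : ∀ {n} {v w : Vec (Fin n) n} → IsPerm v → IsPerm w → encode v ≡ encode w → v ≡ w
encode-injective {v = v} {w} v-perm w-perm eq =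
  trans (sym (tabulate∘lookup v)) (trans (tabulate-cong pointwise) (tabulate∘lookup w))
  where
  same = encode-≡⇒SameCode eq
  pointwise : ∀ i → lookup v i ≡ lookup w i
  pointwise i with label v i in i-label
  ... | lrMax    = same-class⇒≡ lrMax lrMax-increasing lrMax-image v-perm w-perm same i-label
  ... | rlMin    = same-class⇒≡ rlMin rlMin-increasing rlMin-image v-perm w-perm same i-label
  ... | middle _ = trans (proj₂ (proj₂ (label-middle⁻ v i-label)))
                         (sym (proj₂ (proj₂ (label-middle⁻ w (trans (sym (proj₁ same i)) i-label)))))

IsMiddle : ∀ {n} → Label n → Set
IsMiddle lrMax      = ⊥
IsMiddle rlMin      = ⊥
IsMiddle (middle _) = ⊤

isMiddle? : ∀ {n} (l : Label n) → Dec (IsMiddle l)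
isMiddle? lrMax      = no id
isMiddle? rlMin      = no id
isMiddle? (middle _) = yes tt

middleCount : ∀ {n k} → Vec (Label n) k → ℕ
middleCount []              = 0
middleCount (lrMax    ∷ ls) = middleCount ls
middleCount (rlMin    ∷ ls) = middleCount ls
middleCount (middle _ ∷ ls) = suc (middleCount ls)

middleCount-tabulate : ∀ {n k m} (f : Fin m → Label n) (g : Fin k → Fin m) →
  middleCount (tabulate (f ∘ g)) ≡ length (filter (isMiddle? ∘ f) (List.tabulate g))
middleCount-tabulate {k = zero}  f g = refl
middleCount-tabulate {k = suc k} f g with f (g Fin.zero) | middleCount-tabulate f (g ∘ Fin.suc)
... | lrMax    | ih = ih
... | rlMin    | ih = ih
... | middle _ | ih = cong suc ih

¬∀⇒∃¬ : ∀ {n} {P Q : Fin n → Set} → (∀ j → Dec (P j)) → (∀ j → Dec (Q j)) →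
  ¬ (∀ j → P j → Q j) → ∃[ j ] (P j × ¬ Q j)
¬∀⇒∃¬ {n} P? Q? ¬∀ with j , ¬[Pj→Qj] ← Finₚ.¬∀⟶∃¬ n _ (λ j → P? j →-dec Q? j) ¬∀ with P? j
... | yes Pj = j , Pj , λ Qj → ¬[Pj→Qj] (λ _ → Qj)
... | no ¬Pj = contradiction (λ Pj → contradiction Pj ¬Pj) ¬[Pj→Qj]

module _ {n : ℕ} {v : Vec (Fin n) n} (v-perm : IsPerm v) where

  private
    ≮∧≢⇒> : ∀ {i j} → ¬ lookup v j Fin.< lookup v i → i ≢ j → lookup v i Fin.< lookup v j
    ≮∧≢⇒> vⱼ≮vᵢ i≢j = Finₚ.≤∧≢⇒< (≮⇒≥ vⱼ≮vᵢ) (i≢j ∘ lookup-injective v v-perm)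

  ¬IsLRMax⇒larger-before : ∀ {i} → ¬ IsLRMax v i → ∃[ j ] (j Fin.< i × lookup v i Fin.< lookup v j)
  ¬IsLRMax⇒larger-before {i} ¬max
    with j , j<i , vⱼ≮vᵢ ← ¬∀⇒∃¬ (Fin._<? i) (λ j → lookup v j Finₚ.<? lookup v i) ¬max
    = j , j<i , ≮∧≢⇒> vⱼ≮vᵢ (λ { refl → Finₚ.<-irrefl refl j<i })

  ¬IsRLMin⇒smaller-after : ∀ {i} → ¬ IsRLMin v i → ∃[ k ] (i Fin.< k × lookup v k Fin.< lookup v i)
  ¬IsRLMin⇒smaller-after {i} ¬min
    with k , i<k , vᵢ≮vₖ ← ¬∀⇒∃¬ (i Fin.<?_) (λ k → lookup v i Finₚ.<? lookup v k) ¬min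
    = k , i<k , ≮∧≢⇒> vᵢ≮vₖ (λ { refl → Finₚ.<-irrefl refl i<k })

  -- Each middle label is the middle entry of its own copy of 321.
  middleCount≤count321 : middleCount (tabulate (label v)) ≤ count321 v
  middleCount≤count321 = ≤-trans (≤-reflexive (middleCount-tabulate (label v) id))
    (length-≤-by-injection (λ i t → proj₁ (proj₂ t) ≡ i) (Unique.filter⁺ _ (Unique.allFin⁺ n))
      occurrence (λ _ _ eq eq′ → trans (sym eq) eq′))
    where
    occurrence : ∀ {i} → i ∈ filter (isMiddle? ∘ label v) (allFin n) →
      ∃[ t ] (t ∈ filter (occ321? v) (triples n) × proj₁ (proj₂ t) ≡ i)
    occurrence {i} i∈ with label v i in i-label | proj₂ (∈-filter⁻ (isMiddle? ∘ label v) {xs = allFin n} i∈)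
    ... | middle _ | _
      with ¬max , ¬min , _ ← label-middle⁻ v i-label
      with j , j<i , vᵢ<vⱼ ← ¬IsLRMax⇒larger-before ¬max
         | k , i<k , vₖ<vᵢ ← ¬IsRLMin⇒smaller-after ¬min
      = (j , i , k) , ∈-filter⁺ (occ321? v) (∈-triples j i k) (j<i , i<k , vᵢ<vⱼ , vₖ<vᵢ) , refl

labelWords : (n k r : ℕ) → List (Vec (Label n) k)
labelWords n zero    r       = [] ∷ []
labelWords n (suc k) zero    = map (lrMax ∷_) (labelWords n k 0) ++ map (rlMin ∷_) (labelWords n k 0)
labelWords n (suc k) (suc r) =
  map (lrMax ∷_) (labelWords n k (suc r)) ++ map (rlMin ∷_) (labelWords n k (suc r)) ++
  concatMap (λ y → map (middle y ∷_) (labelWords n k r)) (allFin n)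

∈-labelWords : ∀ {n k r} (ls : Vec (Label n) k) → middleCount ls ≤ r → ls ∈ labelWords n k r
∈-labelWords []              _ = here refl
∈-labelWords {r = zero}  (lrMax ∷ ls) c = ∈-++⁺ˡ (∈-map⁺ (lrMax ∷_) (∈-labelWords ls c))
∈-labelWords {r = zero}  (rlMin ∷ ls) c = ∈-++⁺ʳ _ (∈-map⁺ (rlMin ∷_) (∈-labelWords ls c))
∈-labelWords {r = suc r} (lrMax ∷ ls) c = ∈-++⁺ˡ (∈-map⁺ (lrMax ∷_) (∈-labelWords ls c))
∈-labelWords {n} {suc k} {suc r} (rlMin ∷ ls) c =
  ∈-++⁺ʳ (map (lrMax ∷_) (labelWords n k (suc r))) (∈-++⁺ˡ (∈-map⁺ (rlMin ∷_) (∈-labelWords ls c)))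
∈-labelWords {n} {suc k} {suc r} (middle y ∷ ls) (s≤s c) =
  ∈-++⁺ʳ (map (lrMax ∷_) (labelWords n k (suc r))) (∈-++⁺ʳ (map (rlMin ∷_) (labelWords n k (suc r)))
    (∈-concatMap⁺′ (∈-allFin y) (∈-map⁺ (middle y ∷_) (∈-labelWords ls c))))

length-labelWords : ∀ n k r → length (labelWords n k r) ≤ 2 ^ k * suc (k * n) ^ r
length-labelWords n zero    r       = ≤-reflexive (sym (trans (+-identityʳ _) (^-zeroˡ r)))
length-labelWords n (suc k) zero    = begin
  length (map (lrMax ∷_) W ++ map (rlMin ∷_) W)
    ≡⟨ trans (length-++ (map (lrMax ∷_) W)) (cong₂ _+_ (length-map _ W) (length-map _ W)) ⟩
  length W + length W                           ≤⟨ +-mono-≤ (length-labelWords n k 0) (length-labelWords n k 0) ⟩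
  2 ^ k * 1 + 2 ^ k * 1                         ≡⟨ double (2 ^ k) ⟩
  2 ^ suc k * 1                                 ∎
  where
  open ≤-Reasoning
  W = labelWords n k 0
  double : ∀ x → x * 1 + x * 1 ≡ 2 * x * 1
  double = solve-∀
length-labelWords n (suc k) (suc r) = begin
  length (map (lrMax ∷_) W ++ map (rlMin ∷_) W ++ M)
    ≡⟨ trans (length-++ (map (lrMax ∷_) W)) (cong₂ _+_ (length-map _ W) (length-rlMin-part W M)) ⟩
  length W + (length W + length M)                   ≡⟨ cong (λ m → length W + (length W + m)) length-M ⟩
  length W + (length W + n * length W′)              ≤⟨ +-mono-≤ IH (+-mono-≤ IH (*-monoʳ-≤ n IH′)) ⟩
  2 ^ k * (a * a ^ r) + (2 ^ k * (a * a ^ r) + n * (2 ^ k * a ^ r)) ≡⟨ collect (2 ^ k) a (a ^ r) n ⟩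
  2 ^ k * a ^ r * (a + a + n)                        ≤⟨ *-monoʳ-≤ (2 ^ k * a ^ r) (m≤m+n (a + a + n) n) ⟩
  2 ^ k * a ^ r * (a + a + n + n)                    ≡⟨ regroup (2 ^ k) a (a ^ r) n ⟩
  2 ^ suc k * ((a + n) * a ^ r)
    ≤⟨ *-monoʳ-≤ (2 ^ suc k) (*-monoʳ-≤ (a + n) (^-monoˡ-≤ r (m≤m+n a n))) ⟩
  2 ^ suc k * ((a + n) * (a + n) ^ r)
    ≡⟨ cong (λ b → 2 ^ suc k * (b * b ^ r)) (cong suc (+-comm (k * n) n)) ⟩
  2 ^ suc k * suc (suc k * n) ^ suc r                ∎
  where
  open ≤-Reasoning
  W = labelWords n k (suc r)
  W′ = labelWords n k r
  M = concatMap (λ y → map (middle y ∷_) W′) (allFin n)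
  a = suc (k * n)
  IH = length-labelWords n k (suc r)
  IH′ = length-labelWords n k r
  length-rlMin-part : ∀ W M → length (map (rlMin ∷_) W ++ M) ≡ length W + length M
  length-rlMin-part W M = trans (length-++ (map (rlMin ∷_) W)) (cong (_+ length M) (length-map _ W))
  length-M : length M ≡ n * length W′
  length-M = trans (length-concatMap-const _ (allFin n) (λ y → length-map (middle y ∷_) W′))
                   (cong (_* length W′) (length-tabulate {n = n} id))
  collect : ∀ P a ar n → P * (a * ar) + (P * (a * ar) + n * (P * ar)) ≡ P * ar * (a + a + n)
  collect = solve-∀
  regroup : ∀ P a ar n → P * ar * (a + a + n + n) ≡ 2 * P * ((a + n) * ar)
  regroup = solve-∀

s≤4^n*[1+n]^2r : ∀ r n → s r n ≤ 4 ^ n * suc n ^ (2 * r)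
s≤4^n*[1+n]^2r r n = begin
  length (S n r)
    ≤⟨ length-≤-by-injectiveMap encode (Unique-S n r) encode-∈ encode-inj ⟩
  length (cartesianProduct (labelWords n n r) (allWords 2 n))
    ≡⟨ length-cartesianProduct (labelWords n n r) (allWords 2 n) ⟩
  length (labelWords n n r) * length (allWords 2 n)
    ≤⟨ *-mono-≤ (length-labelWords n n r) (≤-reflexive (length-allWords 2 n)) ⟩
  2 ^ n * suc (n * n) ^ r * 2 ^ n                             ≡⟨ regroup (2 ^ n) (suc (n * n) ^ r) ⟩
  2 ^ n * 2 ^ n * suc (n * n) ^ r                             ≡⟨ cong (_* suc (n * n) ^ r) (^-distribʳ-* 2 2 n) ⟨
  4 ^ n * suc (n * n) ^ r
    ≤⟨ *-monoʳ-≤ (4 ^ n) (^-monoˡ-≤ r (m≤n+m (suc (n * n)) (2 * n))) ⟩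
  4 ^ n * (2 * n + suc (n * n)) ^ r                           ≡⟨ cong (λ b → 4 ^ n * b ^ r) (square n) ⟩
  4 ^ n * (suc n ^ 2) ^ r                                     ≡⟨ cong (4 ^ n *_) (^-*-assoc (suc n) 2 r) ⟩
  4 ^ n * suc n ^ (2 * r)                                     ∎
  where
  open ≤-Reasoning
  encode-∈ : ∀ {v} → v ∈ S n r → encode v ∈ cartesianProduct (labelWords n n r) (allWords 2 n)
  encode-∈ {v} v∈ with v-perm , count≡r ← ∈-S⁻ v∈ =
    ∈-cartesianProduct⁺ (∈-labelWords _ (subst (_ ≤_) count≡r (middleCount≤count321 v-perm))) (∈-allWords 2 _)
  encode-inj : ∀ {v w} → v ∈ S n r → w ∈ S n r → encode v ≡ encode w → v ≡ w
  encode-inj v∈ w∈ = encode-injective (proj₁ (∈-S⁻ v∈)) (proj₁ (∈-S⁻ w∈))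
  regroup : ∀ x y → x * y * x ≡ x * x * y
  regroup = solve-∀
  square : ∀ n → 2 * n + suc (n * n) ≡ suc n * (suc n * 1)
  square = solve-∀

-- 321-avoiding words from ballot paths

-- Out-of-range positions read as 0; all uses are guarded by i < length xs.
infixl 9 _‼_
_‼_ : List ℕ → ℕ → ℕ
[]       ‼ _     = 0
(x ∷ xs) ‼ zero  = x
(x ∷ xs) ‼ suc i = xs ‼ i

length-∷ʳ : ∀ (xs : List ℕ) x → length (xs ∷ʳ x) ≡ suc (length xs)
length-∷ʳ []       x = refl
length-∷ʳ (y ∷ xs) x = cong suc (length-∷ʳ xs x)

‼-∷ʳ-old : ∀ (xs : List ℕ) x {i} → i < length xs → (xs ∷ʳ x) ‼ i ≡ xs ‼ i
‼-∷ʳ-old (y ∷ xs) x {zero}  _         = refl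
‼-∷ʳ-old (y ∷ xs) x {suc i} (s≤s i<n) = ‼-∷ʳ-old xs x i<n

‼-∷ʳ-new : ∀ (xs : List ℕ) x → (xs ∷ʳ x) ‼ length xs ≡ x
‼-∷ʳ-new []       x = refl
‼-∷ʳ-new (y ∷ xs) x = ‼-∷ʳ-new xs x

data ∷ʳ-Position (xs : List ℕ) (x : ℕ) : ℕ → Set where
  old : ∀ {i} → i < length xs → (xs ∷ʳ x) ‼ i ≡ xs ‼ i → ∷ʳ-Position xs x i
  new : (xs ∷ʳ x) ‼ length xs ≡ x → ∷ʳ-Position xs x (length xs)

∷ʳ-position : ∀ xs x {i} → i < length (xs ∷ʳ x) → ∷ʳ-Position xs x i
∷ʳ-position xs x {i} i<n with m<1+n⇒m<n∨m≡n (subst (i <_) (length-∷ʳ xs x) i<n)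
... | inj₁ i<len = old i<len (‼-∷ʳ-old xs x i<len)
... | inj₂ refl  = new (‼-∷ʳ-new xs x)

module _ (xs : List ℕ) where

  EveryEntry : (ℕ → Set) → Set
  EveryEntry P = ∀ {i} → i < length xs → P (xs ‼ i)

  InjectiveEntries : Set
  InjectiveEntries = ∀ {i j} → i < length xs → j < length xs → xs ‼ i ≡ xs ‼ j → i ≡ j

  BelowInversions : (ℕ → Set) → Set
  BelowInversions Q = ∀ {i j} → i < j → j < length xs → xs ‼ j < xs ‼ i → Q (xs ‼ j)

  Avoids321 : Set
  Avoids321 = ∀ {i j k} → i < j → j < k → k < length xs → xs ‼ j < xs ‼ i → xs ‼ k < xs ‼ j → ⊥

module _ (xs : List ℕ) (x : ℕ) where

  ∷ʳ-everyEntry : ∀ {P} → EveryEntry xs P → P x → EveryEntry (xs ∷ʳ x) P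
  ∷ʳ-everyEntry {P} every Px i<n with ∷ʳ-position xs x i<n
  ... | old i<len eq = subst P (sym eq) (every i<len)
  ... | new eq       = subst P (sym eq) Px

  ∷ʳ-injectiveEntries : InjectiveEntries xs → EveryEntry xs (_≢ x) → InjectiveEntries (xs ∷ʳ x)
  ∷ʳ-injectiveEntries inj fresh i<n j<n eq with ∷ʳ-position xs x i<n | ∷ʳ-position xs x j<n
  ... | old i<len eqᵢ | old j<len eqⱼ = inj i<len j<len (trans (sym eqᵢ) (trans eq eqⱼ))
  ... | old i<len eqᵢ | new eqⱼ       = contradiction (trans (sym eqᵢ) (trans eq eqⱼ)) (fresh i<len)
  ... | new eqᵢ       | old j<len eqⱼ = contradiction (trans (sym eqⱼ) (trans (sym eq) eqᵢ)) (fresh j<len)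
  ... | new _         | new _         = refl

  ∷ʳ-belowInversions : ∀ {Q} → BelowInversions xs Q → (∀ {i} → i < length xs → x < xs ‼ i → Q x) →
    BelowInversions (xs ∷ʳ x) Q
  ∷ʳ-belowInversions {Q} below new-inversion {i} i<j j<n inv with ∷ʳ-position xs x j<n
  ... | old j<len eqⱼ =
    subst Q (sym eqⱼ) (below i<j j<len (subst₂ _<_ eqⱼ (‼-∷ʳ-old xs x (<-trans i<j j<len)) inv))
  ... | new eqⱼ       = subst Q (sym eqⱼ) (new-inversion i<j (subst₂ _<_ eqⱼ (‼-∷ʳ-old xs x i<j) inv))

  ∷ʳ-avoids321 : Avoids321 xs → BelowInversions xs (_< x) → Avoids321 (xs ∷ʳ x)
  ∷ʳ-avoids321 avoids below {i} {j} i<j j<k k<n inv₁ inv₂ with ∷ʳ-position xs x k<n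
  ... | old k<len eqₖ = avoids i<j j<k k<len (subst₂ _<_ eqⱼ eqᵢ inv₁) (subst₂ _<_ eqₖ eqⱼ inv₂)
    where
    eqⱼ = ‼-∷ʳ-old xs x (<-trans j<k k<len)
    eqᵢ = ‼-∷ʳ-old xs x (<-trans i<j (<-trans j<k k<len))
  ... | new eqₖ = <-asym (subst₂ _<_ eqₖ eqⱼ inv₂) (below i<j j<k (subst₂ _<_ eqⱼ eqᵢ inv₁))
    where
    eqⱼ = ‼-∷ʳ-old xs x j<k
    eqᵢ = ‼-∷ʳ-old xs x (<-trans i<j j<k)

-- A partial 321-avoiding word built from left to right: the entries placed so far,
-- and the values already passed over, which must be placed later in increasing order.
record State : Set where
  constructor ⟨_,_⟩
  field
    placed deferred : List ℕ
open State

defer place : ℕ → State → State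
defer a ⟨ o , p ⟩ = ⟨ o , p ∷ʳ a ⟩
place a ⟨ o , p ⟩ = ⟨ o ∷ʳ a , p ⟩

-- Junk value on an empty deferred list; never used (see released-nonempty).
release : State → State
release ⟨ o , []    ⟩ = ⟨ o , [] ⟩
release ⟨ o , x ∷ p ⟩ = ⟨ o ∷ʳ x , p ⟩

record Invariant (a b : ℕ) (t : State) : Set where
  field
    length-placed      : length (placed t) ≡ b
    length-deferred    : length (deferred t) + b ≡ a
    placed-injective   : InjectiveEntries (placed t)
    placed-bounded     : EveryEntry (placed t) (_< a)
    placed-fresh       : EveryEntry (placed t) (_∉ deferred t)
    deferred-sorted    : AllPairs _<_ (deferred t)
    deferred-bounded   : All (_< a) (deferred t)
    placed-avoids321   : Avoids321 (placed t)
    deferred-above     : BelowInversions (placed t) (λ y → All (y <_) (deferred t))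
open Invariant

initial-invariant : Invariant 0 0 ⟨ [] , [] ⟩
initial-invariant = record
  { length-placed = refl ; length-deferred = refl ; placed-injective = λ ()
  ; placed-bounded = λ () ; placed-fresh = λ () ; deferred-sorted = AllPairs.[]
  ; deferred-bounded = [] ; placed-avoids321 = λ _ _ () ; deferred-above = λ _ () }

defer-invariant : ∀ {a b o p} → Invariant a b ⟨ o , p ⟩ → Invariant (suc a) b ⟨ o , p ∷ʳ a ⟩
defer-invariant {a} {b} {o} {p} I = record
  { length-placed    = length-placed I
  ; length-deferred  = trans (cong (_+ b) (length-∷ʳ p a)) (cong suc (length-deferred I))
  ; placed-injective = placed-injective I
  ; placed-bounded   = λ i<n → m<n⇒m<1+n (placed-bounded I i<n)
  ; placed-fresh     = λ i<n → fresh (placed-fresh I i<n) (placed-bounded I i<n)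
  ; deferred-sorted  = AllPairs.++⁺ (deferred-sorted I) (All.[] AllPairs.∷ AllPairs.[])
                         (All.map (λ y<a → y<a ∷ []) (deferred-bounded I))
  ; deferred-bounded = All.++⁺ (All.map m<n⇒m<1+n (deferred-bounded I)) (≤-refl ∷ [])
  ; placed-avoids321 = placed-avoids321 I
  ; deferred-above   = λ i<j j<n inv →
      All.++⁺ (deferred-above I i<j j<n inv) (placed-bounded I j<n ∷ [])
  }
  where
  fresh : ∀ {y} → y ∉ p → y < a → y ∉ p ∷ʳ a
  fresh y∉p y<a y∈ with ∈-++⁻ p y∈
  ... | inj₁ y∈p        = y∉p y∈p
  ... | inj₂ (here y≡a) = <-irrefl y≡a y<a

place-invariant : ∀ {a b o p} → Invariant a b ⟨ o , p ⟩ → Invariant (suc a) (suc b) ⟨ o ∷ʳ a , p ⟩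
place-invariant {a} {b} {o} {p} I = record
  { length-placed    = trans (length-∷ʳ o a) (cong suc (length-placed I))
  ; length-deferred  = trans (+-suc (length p) b) (cong suc (length-deferred I))
  ; placed-injective = ∷ʳ-injectiveEntries o a (placed-injective I) (<⇒≢ ∘ placed-bounded I)
  ; placed-bounded   = ∷ʳ-everyEntry o a {_< suc a} (m<n⇒m<1+n ∘ placed-bounded I) ≤-refl
  ; placed-fresh     = ∷ʳ-everyEntry o a (placed-fresh I)
                         (λ a∈p → <-irrefl refl (All.lookup (deferred-bounded I) a∈p))
  ; deferred-sorted  = deferred-sorted I
  ; deferred-bounded = All.map m<n⇒m<1+n (deferred-bounded I)
  ; placed-avoids321 = ∷ʳ-avoids321 o a (placed-avoids321 I) (λ _ j<n _ → placed-bounded I j<n)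
  ; deferred-above   = ∷ʳ-belowInversions o a {λ y → All (y <_) p} (deferred-above I)
                         (λ i<n a<oᵢ → contradiction (placed-bounded I i<n) (<⇒≯ a<oᵢ))
  }

release-invariant : ∀ {a b o x p} → Invariant a b ⟨ o , x ∷ p ⟩ → Invariant a (suc b) ⟨ o ∷ʳ x , p ⟩
release-invariant {a} {b} {o} {x} {p} I = record
  { length-placed    = trans (length-∷ʳ o x) (cong suc (length-placed I))
  ; length-deferred  = trans (+-suc (length p) b) (length-deferred I)
  ; placed-injective = ∷ʳ-injectiveEntries o x (placed-injective I)
                         (λ i<n oᵢ≡x → placed-fresh I i<n (here oᵢ≡x))
  ; placed-bounded   = ∷ʳ-everyEntry o x (placed-bounded I) (All.head (deferred-bounded I))
  ; placed-fresh     = ∷ʳ-everyEntry o x (λ i<n y∈p → placed-fresh I i<n (there y∈p))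
                         (λ x∈p → <-irrefl refl (All.lookup x<p x∈p))
  ; deferred-sorted  = AllPairs.tail (deferred-sorted I)
  ; deferred-bounded = All.tail (deferred-bounded I)
  ; placed-avoids321 = ∷ʳ-avoids321 o x (placed-avoids321 I)
                         (λ i<j j<n inv → All.head (deferred-above I i<j j<n inv))
  ; deferred-above   = ∷ʳ-belowInversions o x
                         (λ i<j j<n inv → All.tail (deferred-above I i<j j<n inv)) (λ _ _ → x<p)
  }
  where
  x<p : All (x <_) p
  x<p = AllPairs.head (deferred-sorted I)

mutual
  -- states a b: the values 0, …, a − 1 are processed and b entries are placed.
  states : ℕ → ℕ → List State
  states zero    b = released zero b
  states (suc a) b = map (defer a) (states a b) ++ released (suc a) b

  -- The states whose last move placed an entry; only these may release next,
  -- which makes every word arise from a single sequence of moves.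
  released : ℕ → ℕ → List State
  released zero    zero    = ⟨ [] , [] ⟩ ∷ []
  released zero    (suc b) = []
  released (suc a) zero    = []
  released (suc a) (suc b) with b ≤? a
  ... | yes _ = map (place a) (states a b) ++ map release (released (suc a) b)
  ... | no  _ = []

released⊆states : ∀ a b {t} → t ∈ released a b → t ∈ states a b
released⊆states zero    b t∈ = t∈
released⊆states (suc a) b t∈ = ∈-++⁺ʳ (map (defer a) (states a b)) t∈

states-invariant : ∀ a b {t} → t ∈ states a b → Invariant a b t
states-invariant zero    zero    (here refl) = initial-invariant
states-invariant (suc a) b       t∈ with ∈-++⁻ (map (defer a) (states a b)) t∈
... | inj₁ t∈defer with ⟨ _ , _ ⟩ , t′∈ , refl ← ∈-map⁻ (defer a) t∈defer =
  defer-invariant (states-invariant a b t′∈)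
states-invariant (suc a) zero    t∈ | inj₂ ()
states-invariant (suc a) (suc b) t∈ | inj₂ t∈released with b ≤? a
... | yes b≤a with ∈-++⁻ (map (place a) (states a b)) t∈released
...   | inj₁ t∈place with ⟨ _ , _ ⟩ , t′∈ , refl ← ∈-map⁻ (place a) t∈place =
        place-invariant (states-invariant a b t′∈)
...   | inj₂ t∈release with ∈-map⁻ release t∈release
...     | ⟨ _ , x ∷ p ⟩ , t′∈ , refl =
          release-invariant (states-invariant (suc a) b (released⊆states (suc a) b t′∈))
...     | ⟨ _ , []    ⟩ , t′∈ , refl =
          contradiction (length-deferred (states-invariant (suc a) b (released⊆states (suc a) b t′∈)))
                        (<⇒≢ (s≤s b≤a))

released-nonempty : ∀ {a b o} → b ≤ a → ⟨ o , [] ⟩ ∈ released (suc a) b → ⊥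
released-nonempty {a} {b} b≤a t∈ =
  <⇒≢ (s≤s b≤a) (length-deferred (states-invariant (suc a) b (released⊆states (suc a) b t∈)))

released-deferred-below : ∀ a b {t} → t ∈ released a b → All (λ y → suc y < a) (deferred t)
released-deferred-below zero    zero    (here refl) = []
released-deferred-below (suc a) (suc b) t∈ with b ≤? a
... | yes _ with ∈-++⁻ (map (place a) (states a b)) t∈
...   | inj₁ t∈place with ⟨ _ , _ ⟩ , t′∈ , refl ← ∈-map⁻ (place a) t∈place =
        All.map s≤s (deferred-bounded (states-invariant a b t′∈))
...   | inj₂ t∈release with ∈-map⁻ release t∈release
...     | ⟨ _ , _ ∷ _ ⟩ , t′∈ , refl = All.tail (released-deferred-below (suc a) b t′∈)
...     | ⟨ _ , []    ⟩ , t′∈ , refl = []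

mutual
  states-unique : ∀ a b → Unique (states a b)
  states-unique zero    b = released-unique zero b
  states-unique (suc a) b =
    Unique.++⁺ (Unique.map⁺ defer-injective (states-unique a b)) (released-unique (suc a) b) disjoint
    where
    defer-injective : ∀ {t t′} → defer a t ≡ defer a t′ → t ≡ t′
    defer-injective {⟨ _ , p ⟩} {⟨ _ , p′ ⟩} eq =
      cong₂ ⟨_,_⟩ (cong placed eq) (∷ʳ-injectiveˡ p p′ (cong deferred eq))
    disjoint : ∀ {t} → ¬ (t ∈ map (defer a) (states a b) × t ∈ released (suc a) b)
    disjoint (t∈defer , t∈released) with ⟨ _ , p ⟩ , _ , refl ← ∈-map⁻ (defer a) t∈defer =
      <-irrefl refl (≤-pred (All.lookup (released-deferred-below (suc a) b t∈released) (∈-++⁺ʳ p (here refl))))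

  released-unique : ∀ a b → Unique (released a b)
  released-unique zero    zero    = All.[] Unique.∷ Unique.[]
  released-unique zero    (suc b) = Unique.[]
  released-unique (suc a) zero    = Unique.[]
  released-unique (suc a) (suc b) with b ≤? a
  ... | no  _   = Unique.[]
  ... | yes b≤a = Unique.++⁺ (Unique.map⁺ place-injective (states-unique a b))
                    (Unique-map⁺ release release-injective (released-unique (suc a) b)) disjoint
    where
    place-injective : ∀ {t t′} → place a t ≡ place a t′ → t ≡ t′
    place-injective {⟨ o , _ ⟩} {⟨ o′ , _ ⟩} eq =
      cong₂ ⟨_,_⟩ (∷ʳ-injectiveˡ o o′ (cong placed eq)) (cong deferred eq)
    release-injective : ∀ {t t′} → t ∈ released (suc a) b → t′ ∈ released (suc a) b →
      release t ≡ release t′ → t ≡ t′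
    release-injective {⟨ _ , [] ⟩} t∈ _ _ = contradiction t∈ (released-nonempty b≤a)
    release-injective {⟨ _ , _ ∷ _ ⟩} {⟨ _ , [] ⟩} _ t′∈ _ = contradiction t′∈ (released-nonempty b≤a)
    release-injective {⟨ o , x ∷ _ ⟩} {⟨ o′ , x′ ∷ _ ⟩} _ _ eq
      with refl , refl ← ∷ʳ-injective o o′ (cong placed eq) =
      cong (λ p → ⟨ o , x ∷ p ⟩) (cong deferred eq)
    disjoint : ∀ {t} → ¬ (t ∈ map (place a) (states a b) × t ∈ map release (released (suc a) b))
    disjoint (t∈place , t∈release)
      with ⟨ o , _ ⟩ , _ , refl ← ∈-map⁻ (place a) t∈place with ∈-map⁻ release t∈release
    ... | ⟨ _ , [] ⟩ , t′∈ , _ = released-nonempty b≤a t′∈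
    ... | ⟨ o′ , x ∷ _ ⟩ , t′∈ , eq with refl ← ∷ʳ-injectiveʳ o o′ (cong placed eq) =
      <-irrefl refl (≤-pred (All.head (released-deferred-below (suc a) b t′∈)))

stateCount : ℕ → ℕ → ℕ
stateCount a b = length (states a b)

stateCount-suc : ∀ a b → stateCount (suc a) b ≡ stateCount a b + length (released (suc a) b)
stateCount-suc a b = trans (length-++ (map (defer a) (states a b)))
  (cong (_+ length (released (suc a) b)) (length-map (defer a) (states a b)))

length-released : ∀ a b → b ≤ a → length (released (suc a) (suc b)) ≡ stateCount (suc a) b
length-released a b b≤a with b ≤? a
... | no b≰a = contradiction b≤a b≰a
... | yes _  = begin
  length (map (place a) (states a b) ++ map release (released (suc a) b))
    ≡⟨ length-++ (map (place a) (states a b)) ⟩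
  length (map (place a) (states a b)) + length (map release (released (suc a) b))
    ≡⟨ cong₂ _+_ (length-map (place a) (states a b)) (length-map release (released (suc a) b)) ⟩
  stateCount a b + length (released (suc a) b)
    ≡⟨ stateCount-suc a b ⟨
  stateCount (suc a) b ∎
  where open ≡-Reasoning

stateCount-zero : ∀ a → stateCount a 0 ≡ 1
stateCount-zero zero    = refl
stateCount-zero (suc a) = trans (stateCount-suc a 0) (trans (+-identityʳ _) (stateCount-zero a))

stateCount-< : ∀ a b → a < b → stateCount a b ≡ 0
stateCount-< zero    (suc b) _         = refl
stateCount-< (suc a) (suc b) (s≤s a<b) =
  trans (stateCount-suc a (suc b)) (cong₂ _+_ (stateCount-< a (suc b) (m<n⇒m<1+n a<b)) released-empty)
  where
  released-empty : length (released (suc a) (suc b)) ≡ 0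
  released-empty with b ≤? a
  ... | no  _   = refl
  ... | yes b≤a = contradiction (<-≤-trans a<b b≤a) (<-irrefl refl)

stateCount-rec : ∀ a b → b ≤ a → stateCount (suc a) (suc b) ≡ stateCount a (suc b) + stateCount (suc a) b
stateCount-rec a b b≤a = trans (stateCount-suc a (suc b)) (cong (stateCount a (suc b) +_) (length-released a b b≤a))

choose-pred : ℕ → ℕ → ℕ
choose-pred m zero    = 0
choose-pred m (suc k) = m choose k

pascal : ∀ m k → suc m choose k ≡ choose-pred m k + m choose k
pascal m zero    = refl
pascal m (suc k) = refl

ballot : ∀ a b → b ≤ a → stateCount a b + choose-pred (a + b) b ≡ (a + b) choose b
ballot a       zero    _         = trans (+-identityʳ _) (stateCount-zero a)
ballot (suc a) (suc b) (s≤s b≤a) =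
  subst (λ m → stateCount (suc a) (suc b) + choose-pred (suc m) (suc b) ≡ suc m choose suc b)
  (sym (+-suc a b)) (begin
    stateCount (suc a) (suc b) + suc (suc m) choose b
      ≡⟨ cong₂ _+_ (stateCount-rec a b b≤a) (pascal (suc m) b) ⟩
    (stateCount a (suc b) + stateCount (suc a) b) + (choose-pred (suc m) b + suc m choose b)
      ≡⟨ regroup (stateCount a (suc b)) (stateCount (suc a) b) (choose-pred (suc m) b) (suc m choose b) ⟩
    (stateCount a (suc b) + suc m choose b) + (stateCount (suc a) b + choose-pred (suc m) b)
      ≡⟨ cong₂ _+_ first (ballot (suc a) b (m≤n⇒m≤1+n b≤a)) ⟩
    suc m choose suc b + suc m choose b
      ≡⟨ +-comm (suc m choose suc b) (suc m choose b) ⟩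
    suc (suc m) choose suc b ∎)
  where
  open ≡-Reasoning
  m = a + b
  first : stateCount a (suc b) + suc m choose b ≡ suc m choose suc b
  first with m≤n⇒m<n∨m≡n b≤a
  ... | inj₁ b<a = subst (λ k → stateCount a (suc b) + choose-pred k (suc b) ≡ k choose suc b)
                         (+-suc a b) (ballot a (suc b) b<a)
  ... | inj₂ refl = trans (cong (_+ suc m choose b) (stateCount-< b (suc b) ≤-refl)) (choose-middle-symmetric b)
  regroup : ∀ x y z w → (x + y) + (z + w) ≡ (x + w) + (y + z)
  regroup = solve-∀

catalan : ∀ n → suc n * stateCount n n ≡ (n + n) choose n
catalan zero    = refl
catalan (suc k) = +-cancelʳ-≡ (suc k * C) _ _ (begin
  (2 + k) * L + suc k * C         ≡⟨ cong ((2 + k) * L +_) ratio ⟩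
  (2 + k) * L + (2 + k) * D       ≡⟨ *-distribˡ-+ (2 + k) L D ⟨
  (2 + k) * (L + D)               ≡⟨ cong ((2 + k) *_) (ballot (suc k) (suc k) ≤-refl) ⟩
  C + suc k * C                   ∎)
  where
  open ≡-Reasoning
  m = suc k + suc k
  C = m choose suc k
  D = m choose k
  L = stateCount (suc k) (suc k)
  ratio : suc k * C ≡ (2 + k) * D
  ratio = subst (λ m → suc k * m choose suc k ≡ (2 + k) * m choose k) (+-suc k (suc k)) (choose-ratio k (2 + k))

4^n≤[1+2n]*[1+n]*stateCount : ∀ n → 4 ^ n ≤ suc (n + n) * (suc n * stateCount n n)
4^n≤[1+2n]*[1+n]*stateCount n =
  subst (4 ^ n ≤_) (cong (suc (n + n) *_) (sym (catalan n))) (4^n≤[1+2n]*central-binomial n)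

‼-extensionality : ∀ {xs ys} → length xs ≡ length ys →
  (∀ {i} → i < length xs → xs ‼ i ≡ ys ‼ i) → xs ≡ ys
‼-extensionality {[]}     {[]}     _   _     = refl
‼-extensionality {x ∷ xs} {y ∷ ys} len≡ entry≡ =
  cong₂ _∷_ (entry≡ (s≤s z≤n)) (‼-extensionality (suc-injective len≡) (entry≡ ∘ s≤s))

deferred-empty : ∀ {m o p} → Invariant m m ⟨ o , p ⟩ → p ≡ []
deferred-empty {p = []}        _ = refl
deferred-empty {m} {p = x ∷ p} I = contradiction (length-deferred I) (<⇒≢ (s≤s (m≤n+m m (length p))) ∘ sym)

-- The lower bound: a prefix with exactly r copies of 321

toℕ-mod : ∀ {x n} .{{_ : NonZero n}} → x < n → toℕ (x mod n) ≡ x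
toℕ-mod {x} {n} x<n = trans (Finₚ.toℕ-fromℕ< _) (m<n⇒m%n≡m x<n)

<⊎≡+ : ∀ c i → i < c ⊎ ∃[ j ] (i ≡ c + j)
<⊎≡+ c i with i <? c
... | yes i<c = inj₁ i<c
... | no  i≮c = inj₂ (i ∸ c , sym (m+[n∸m]≡n (≮⇒≥ i≮c)))

-- r + 1, r, 0, 1, …, r − 1: its copies of 321 are exactly at (0, 1, k) with 2 ≤ k ≤ r + 1.
prefix : ℕ → ℕ → ℕ
prefix r zero          = suc r
prefix r (suc zero)    = r
prefix r (suc (suc j)) = j

prefix≤ : ∀ r {i} → i < 2 + r → prefix r i ≤ suc r
prefix≤ r {zero}        _                 = ≤-refl
prefix≤ r {suc zero}    _                 = n≤1+n r
prefix≤ r {suc (suc j)} (s≤s (s≤s j<r)) = m≤n⇒m≤1+n (<⇒≤ j<r)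

prefix-injective : ∀ r {i j} → i < 2 + r → j < 2 + r → prefix r i ≡ prefix r j → i ≡ j
prefix-injective r {zero}        {zero}        _ _ _ = refl
prefix-injective r {zero}        {suc zero}    _ _ eq = contradiction (sym eq) (<⇒≢ (n<1+n r))
prefix-injective r {zero}        {suc (suc j)} _ (s≤s (s≤s j<r)) eq = contradiction (sym eq) (<⇒≢ (m<n⇒m<1+n j<r))
prefix-injective r {suc zero}    {zero}        _ _ eq = contradiction eq (<⇒≢ (n<1+n r))
prefix-injective r {suc zero}    {suc zero}    _ _ _ = refl
prefix-injective r {suc zero}    {suc (suc j)} _ (s≤s (s≤s j<r)) eq = contradiction (sym eq) (<⇒≢ j<r)
prefix-injective r {suc (suc i)} {zero}        (s≤s (s≤s i<r)) _ eq = contradiction eq (<⇒≢ (m<n⇒m<1+n i<r))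
prefix-injective r {suc (suc i)} {suc zero}    (s≤s (s≤s i<r)) _ eq = contradiction eq (<⇒≢ i<r)
prefix-injective r {suc (suc i)} {suc (suc j)} _ _ eq = cong (2 +_) eq

prefix-321 : ∀ r {i j k} → i < j → j < k → k < 2 + r → prefix r k < prefix r j →
  i ≡ 0 × j ≡ 1 × 2 ≤ k
prefix-321 r {zero} {suc zero} {suc (suc k)} _ _ _ _ = refl , refl , s≤s (s≤s z≤n)
prefix-321 r {suc i} {suc zero} (s≤s ()) _ _ _
prefix-321 r {j = suc zero} {suc zero} _ (s≤s ()) _ _
prefix-321 r {j = suc (suc j)} {suc (suc k)} _ (s≤s (s≤s j<k)) _ k<j = contradiction j<k (<-asym k<j)
prefix-321 r {j = suc (suc j)} {suc zero} _ (s≤s ()) _ _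

module Embedding (r m : ℕ) (σ : List ℕ) where

  c = 2 + r
  n = c + m

  entry : ℕ → ℕ
  entry i with i <? c
  ... | yes _ = prefix r i
  ... | no  _ = σ ‼ (i ∸ c) + c

  -- mod n only serves as a total map ℕ → Fin n: every entry is below n.
  value : Fin n → Fin n
  value i = entry (toℕ i) mod n

  perm : Vec (Fin n) n
  perm = tabulate value

  entry-prefix : ∀ {i} → i < c → entry i ≡ prefix r i
  entry-prefix {i} i<c with i <? c
  ... | yes _   = refl
  ... | no  i≮c = contradiction i<c i≮c

  entry-suffix : ∀ j → entry (c + j) ≡ σ ‼ j + c
  entry-suffix j with c + j <? c
  ... | yes c+j<c = contradiction c+j<c (m+n≮m c j)
  ... | no  _     = cong (λ i → σ ‼ i + c) (m+n∸m≡n c j)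

  module _ {p : List ℕ} (I : Invariant m m ⟨ σ , p ⟩) where

    σ-bounded : ∀ {j} → j < m → σ ‼ j < m
    σ-bounded j<m = placed-bounded I (subst (_ <_) (sym (length-placed I)) j<m)

    prefix<suffix : ∀ {i} j → i < c → entry i < entry (c + j)
    prefix<suffix {i} j i<c = subst₂ _<_ (sym (entry-prefix i<c)) (sym (entry-suffix j))
      (<-≤-trans (s≤s (prefix≤ r i<c)) (m≤n+m c (σ ‼ j)))

    entry-bounded : ∀ {i} → i < n → entry i < n
    entry-bounded {i} i<n with <⊎≡+ c i
    ... | inj₁ i<c        = subst (_< n) (sym (entry-prefix i<c)) (<-≤-trans (s≤s (prefix≤ r i<c)) (m≤m+n c m))
    ... | inj₂ (j , refl) = subst (_< n) (sym (entry-suffix j))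
      (subst (σ ‼ j + c <_) (+-comm m c) (+-monoˡ-< c (σ-bounded (+-cancelˡ-< c j m i<n))))

    entry-injective : ∀ {i j} → i < n → j < n → entry i ≡ entry j → i ≡ j
    entry-injective {i} {j} i<n j<n eq with <⊎≡+ c i | <⊎≡+ c j
    ... | inj₁ i<c | inj₁ j<c = prefix-injective r i<c j<c
      (trans (sym (entry-prefix i<c)) (trans eq (entry-prefix j<c)))
    ... | inj₁ i<c | inj₂ (j′ , refl) = contradiction eq (<⇒≢ (prefix<suffix j′ i<c))
    ... | inj₂ (i′ , refl) | inj₁ j<c = contradiction (sym eq) (<⇒≢ (prefix<suffix i′ j<c))
    ... | inj₂ (i′ , refl) | inj₂ (j′ , refl) = cong (c +_) (placed-injective I
      (subst (i′ <_) (sym (length-placed I)) (+-cancelˡ-< c i′ m i<n))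
      (subst (j′ <_) (sym (length-placed I)) (+-cancelˡ-< c j′ m j<n))
      (+-cancelʳ-≡ c _ _ (trans (sym (entry-suffix i′)) (trans eq (entry-suffix j′)))))

    entry-321 : ∀ {i j k} → i < j → j < k → k < n → entry j < entry i → entry k < entry j →
      i ≡ 0 × j ≡ 1 × 2 ≤ k × k < c
    entry-321 {i} {j} {k} i<j j<k k<n inv₁ inv₂ with <⊎≡+ c k
    ... | inj₁ k<c = let i≡0 , j≡1 , 2≤k = prefix-321 r i<j j<k k<c
                           (subst₂ _<_ (entry-prefix k<c) (entry-prefix (<-trans j<k k<c)) inv₂)
                     in i≡0 , j≡1 , 2≤k , k<c
    ... | inj₂ (k′ , refl) with <⊎≡+ c j
    ...   | inj₁ j<c = contradiction inv₂ (<-asym (prefix<suffix k′ j<c))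
    ...   | inj₂ (j′ , refl) with <⊎≡+ c i
    ...     | inj₁ i<c = contradiction inv₁ (<-asym (prefix<suffix j′ i<c))
    ...     | inj₂ (i′ , refl) = contradiction
      (subst₂ _<_ (entry-suffix k′) (entry-suffix j′) inv₂)
      (placed-avoids321 I (+-cancelˡ-< c i′ j′ i<j) (+-cancelˡ-< c j′ k′ j<k)
        (subst (k′ <_) (sym (length-placed I)) (+-cancelˡ-< c k′ m k<n))
        (+-cancelʳ-< c _ _ (subst₂ _<_ (entry-suffix j′) (entry-suffix i′) inv₁)) ∘ +-cancelʳ-< c _ _)

    toℕ-perm : ∀ i → toℕ (lookup perm i) ≡ entry (toℕ i)
    toℕ-perm i = trans (cong toℕ (lookup∘tabulate value i)) (toℕ-mod (entry-bounded (Finₚ.toℕ<n i)))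

    perm-IsPerm : IsPerm perm
    perm-IsPerm = subst Unique (sym (toList-tabulate value)) (Unique.tabulate⁺ (λ {i} {j} eq →
      Finₚ.toℕ-injective (entry-injective (Finₚ.toℕ<n i) (Finₚ.toℕ<n j)
        (trans (sym (toℕ-value i)) (trans (cong toℕ eq) (toℕ-value j))))))
      where
      toℕ-value : ∀ i → toℕ (value i) ≡ entry (toℕ i)
      toℕ-value i = toℕ-mod (entry-bounded (Finₚ.toℕ<n i))

    occurrence-shape : ∀ {a b k} → Occ321 perm (a , b , k) →
      toℕ a ≡ 0 × toℕ b ≡ 1 × 2 ≤ toℕ k × toℕ k < c
    occurrence-shape {a} {b} {k} (a<b , b<k , inv₁ , inv₂) = entry-321 a<b b<k (Finₚ.toℕ<n k)
      (subst₂ _<_ (toℕ-perm b) (toℕ-perm a) inv₁) (subst₂ _<_ (toℕ-perm k) (toℕ-perm b) inv₂)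

    Occurrences = filter (occ321? perm) (triples n)

    count321≤r : count321 perm ≤ r
    count321≤r = begin
      length Occurrences
        ≤⟨ length-≤-by-injectiveMap third∸2 (Unique.filter⁺ (occ321? perm) (Unique-triples n))
                                    third∸2∈ third∸2-injective ⟩
      length (upTo r)    ≡⟨ length-upTo r ⟩
      r                  ∎
      where
      open ≤-Reasoning
      third∸2 : Fin n × Fin n × Fin n → ℕ
      third∸2 (_ , _ , k) = toℕ k ∸ 2
      shape : ∀ {a b k} → (a , b , k) ∈ Occurrences → toℕ a ≡ 0 × toℕ b ≡ 1 × 2 ≤ toℕ k × toℕ k < c
      shape t∈ = occurrence-shape (proj₂ (∈-filter⁻ (occ321? perm) {xs = triples n} t∈))
      third∸2∈ : ∀ {t} → t ∈ Occurrences → third∸2 t ∈ upTo r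
      third∸2∈ {_ , _ , _} t∈ = let _ , _ , 2≤k , k<c = shape t∈ in ∈-upTo⁺ (∸-monoˡ-< k<c 2≤k)
      third∸2-injective : ∀ {t t′} → t ∈ Occurrences → t′ ∈ Occurrences →
        third∸2 t ≡ third∸2 t′ → t ≡ t′
      third∸2-injective {a , b , k} {a′ , b′ , k′} t∈ t′∈ eq
        with a≡0 , b≡1 , 2≤k , _ ← shape t∈ | a′≡0 , b′≡1 , 2≤k′ , _ ← shape t′∈
        with refl ← Finₚ.toℕ-injective (trans a≡0 (sym a′≡0))
           | refl ← Finₚ.toℕ-injective (trans b≡1 (sym b′≡1))
           | refl ← Finₚ.toℕ-injective (∸-cancelʳ-≡ 2≤k 2≤k′ eq) = refl

    r≤count321 : r ≤ count321 perm
    r≤count321 = begin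
      r                  ≡⟨ length-upTo r ⟨
      length (upTo r)
        ≤⟨ length-≤-by-injectiveMap occurrence (Unique.upTo⁺ r) occurrence∈ occurrence-injective ⟩
      length Occurrences ∎
      where
      open ≤-Reasoning
      occurrence : ℕ → Fin n × Fin n × Fin n
      occurrence j = 0 mod n , 1 mod n , (2 + j) mod n
      2+j<n : ∀ {j} → j < r → 2 + j < n
      2+j<n j<r = ≤-trans (s≤s (s≤s j<r)) (m≤m+n c m)
      occurrence-injective : ∀ {j j′} → j ∈ upTo r → j′ ∈ upTo r →
        occurrence j ≡ occurrence j′ → j ≡ j′
      occurrence-injective j∈ j′∈ eq = suc-injective (suc-injective (trans (sym (toℕ-mod (2+j<n (∈-upTo⁻ j∈))))
        (trans (cong (λ t → toℕ (proj₂ (proj₂ t))) eq) (toℕ-mod (2+j<n (∈-upTo⁻ j′∈))))))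
      occurrence∈ : ∀ {j} → j ∈ upTo r → occurrence j ∈ Occurrences
      occurrence∈ {j} j∈ = ∈-filter⁺ (occ321? perm) (∈-triples _ _ _) (0<1 , 1<k , v₁<v₀ , vₖ<v₁)
        where
        j<r = ∈-upTo⁻ j∈
        0<n : 0 < n
        0<n = s≤s z≤n
        1<n : 1 < n
        1<n = s≤s (s≤s z≤n)
        toℕ-k : toℕ ((2 + j) mod n) ≡ 2 + j
        toℕ-k = toℕ-mod (2+j<n j<r)
        entry-at : ∀ {i} (i<n : i < n) → toℕ (lookup perm (i mod n)) ≡ entry i
        entry-at {i} i<n = trans (toℕ-perm (i mod n)) (cong entry (toℕ-mod i<n))
        0<1 : (0 mod n) Fin.< (1 mod n)
        0<1 = subst₂ _<_ (sym (toℕ-mod 0<n)) (sym (toℕ-mod 1<n)) (s≤s z≤n)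
        1<k : (1 mod n) Fin.< ((2 + j) mod n)
        1<k = subst₂ _<_ (sym (toℕ-mod 1<n)) (sym toℕ-k) (s≤s (s≤s z≤n))
        v₁<v₀ : lookup perm (1 mod n) Fin.< lookup perm (0 mod n)
        v₁<v₀ = subst₂ _<_ (sym (trans (entry-at 1<n) (entry-prefix (s≤s (s≤s z≤n)))))
                           (sym (trans (entry-at 0<n) (entry-prefix (s≤s z≤n)))) ≤-refl
        vₖ<v₁ : lookup perm ((2 + j) mod n) Fin.< lookup perm (1 mod n)
        vₖ<v₁ = subst₂ _<_ (sym (trans (entry-at (2+j<n j<r)) (entry-prefix (s≤s (s≤s j<r)))))
                           (sym (trans (entry-at 1<n) (entry-prefix (s≤s (s≤s z≤n))))) j<r

    count321-perm : count321 perm ≡ r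
    count321-perm = ≤-antisym count321≤r r≤count321

    suffix-value : ∀ {j} → j < m → toℕ (lookup perm ((c + j) mod n)) ≡ σ ‼ j + c
    suffix-value {j} j<m =
      trans (toℕ-perm ((c + j) mod n)) (trans (cong entry (toℕ-mod (+-monoʳ-< c j<m))) (entry-suffix j))

stateCount≤s : ∀ r m → stateCount m m ≤ s r (2 + r + m)
stateCount≤s r m = length-≤-by-injectiveMap (perm ∘ placed) (states-unique m m) perm∈ perm-injective
  where
  open Embedding r m
  perm∈ : ∀ {t} → t ∈ states m m → perm (placed t) ∈ S (2 + r + m) r
  perm∈ t∈ = let I = states-invariant m m t∈ in ∈-S⁺ _ (perm-IsPerm _ I) (count321-perm _ I)
  perm-injective : ∀ {t t′} → t ∈ states m m → t′ ∈ states m m →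
    perm (placed t) ≡ perm (placed t′) → t ≡ t′
  perm-injective {t} {t′} t∈ t′∈ eq = cong₂ ⟨_,_⟩
    (‼-extensionality (trans (length-placed I) (sym (length-placed I′))) (λ {j} j<len →
      let j<m = subst (j <_) (length-placed I) j<len in
      +-cancelʳ-≡ (2 + r) _ _ (trans (sym (suffix-value _ I j<m))
        (trans (cong (λ v → toℕ (lookup v ((2 + r + j) mod (2 + r + m)))) eq) (suffix-value _ I′ j<m)))))
    (trans (deferred-empty I) (sym (deferred-empty I′)))
    where
    I  = states-invariant m m t∈
    I′ = states-invariant m m t′∈

4^n≤[1+n]^[2r+7]*s : ∀ r m → let n = 2 + r + m in 4 ^ n ≤ suc n ^ (2 * (2 + r) + 3) * s r n
4^n≤[1+n]^[2r+7]*s r m = begin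
  4 ^ (c + m)                                           ≡⟨ ^-distribˡ-+-* 4 c m ⟩
  4 ^ c * 4 ^ m                                         ≤⟨ *-monoʳ-≤ (4 ^ c) (4^n≤[1+2n]*[1+n]*stateCount m) ⟩
  4 ^ c * (suc (m + m) * (suc m * stateCount m m))
    ≤⟨ *-monoʳ-≤ (4 ^ c) (*-monoʳ-≤ (suc (m + m)) (*-monoʳ-≤ (suc m) (stateCount≤s r m))) ⟩
  4 ^ c * (suc (m + m) * (suc m * s r n))
    ≤⟨ *-mono-≤ 4^c≤ (*-mono-≤ 2m+1≤ (*-monoˡ-≤ (s r n) (s≤s (m≤n+m m c)))) ⟩
  N ^ (2 * c) * (N ^ 2 * (N * s r n))                    ≡⟨ regroup (N ^ (2 * c)) N (s r n) ⟩
  N ^ (2 * c) * N ^ 3 * s r n                            ≡⟨ cong (_* s r n) (^-distribˡ-+-* N (2 * c) 3) ⟨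
  N ^ (2 * c + 3) * s r n                                ∎
  where
  open ≤-Reasoning
  c = 2 + r
  n = c + m
  N = suc n
  1+2n≤N^2 : suc (n + n) ≤ N ^ 2
  1+2n≤N^2 = ≤-trans (m≤m+n (suc (n + n)) (n * n)) (≤-reflexive (square n))
    where
    square : ∀ n → suc (n + n) + n * n ≡ suc n * (suc n * 1)
    square = solve-∀
  4^c≤ : 4 ^ c ≤ N ^ (2 * c)
  4^c≤ = ≤-trans (^-monoˡ-≤ c (*-mono-≤ 2≤N (≤-trans 2≤N (≤-reflexive (sym (*-identityʳ N))))))
                 (≤-reflexive (^-*-assoc N 2 c))
    where
    2≤N : 2 ≤ N
    2≤N = s≤s (s≤s z≤n)
  2m+1≤ : suc (m + m) ≤ N ^ 2
  2m+1≤ = ≤-trans (s≤s (+-mono-≤ (m≤n+m m c) (m≤n+m m c))) 1+2n≤N^2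
  regroup : ∀ a N x → a * (N * (N * 1) * (N * x)) ≡ a * (N * (N * (N * 1))) * x
  regroup = solve-∀

growth-rate≤4 : ∀ r p q → 4 * q < p → Eventually (λ n → s r n * q ^ n ≤ p ^ n)
growth-rate≤4 r p q 4q<p with N , dominated ← exponential-dominates-polynomial (2 * r) (4 * q) =
  N , λ n N≤n → begin
    s r n * q ^ n                    ≤⟨ *-monoˡ-≤ (q ^ n) (s≤4^n*[1+n]^2r r n) ⟩
    4 ^ n * suc n ^ (2 * r) * q ^ n  ≡⟨ swap (4 ^ n) (suc n ^ (2 * r)) (q ^ n) ⟩
    4 ^ n * q ^ n * suc n ^ (2 * r)  ≡⟨ cong (_* suc n ^ (2 * r)) (^-distribʳ-* 4 q n) ⟨
    (4 * q) ^ n * suc n ^ (2 * r)    ≤⟨ dominated n N≤n ⟩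
    suc (4 * q) ^ n                  ≤⟨ ^-monoˡ-≤ n 4q<p ⟩
    p ^ n                            ∎
  where
  open ≤-Reasoning
  swap : ∀ a b c → a * b * c ≡ a * c * b
  swap = solve-∀

growth-rate≥4 : ∀ r p q → p < 4 * q → ∀ N → ∃[ n ] (N ≤ n × p ^ n ≤ s r n * q ^ n)
growth-rate≥4 r p q p<4q N =
  let M , dominated = exponential-dominates-polynomial k p
      n = 2 + r + (N + M)
  in n , ≤-trans (m≤m+n N M) (m≤n+m (N + M) (2 + r)) , *-cancelˡ-≤ (suc n ^ k) {{m^n≢0 (suc n) k}} (begin
    suc n ^ k * p ^ n           ≡⟨ *-comm (suc n ^ k) (p ^ n) ⟩
    p ^ n * suc n ^ k           ≤⟨ dominated n (≤-trans (m≤n+m M N) (m≤n+m (N + M) (2 + r))) ⟩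
    suc p ^ n                   ≤⟨ ^-monoˡ-≤ n p<4q ⟩
    (4 * q) ^ n                 ≡⟨ ^-distribʳ-* 4 q n ⟩
    4 ^ n * q ^ n               ≤⟨ *-monoˡ-≤ (q ^ n) (4^n≤[1+n]^[2r+7]*s r (N + M)) ⟩
    suc n ^ k * s r n * q ^ n   ≡⟨ *-assoc (suc n ^ k) (s r n) (q ^ n) ⟩
    suc n ^ k * (s r n * q ^ n) ∎)
  where
  open ≤-Reasoning
  k = 2 * (2 + r) + 3

mainTheorem3 : (r : ℕ) →
    ((p q : ℕ) → 4 * q < p → ∃[ N ] ((n : ℕ) → N ≤ n → s r n * q ^ n ≤ p ^ n))
    × ((p q : ℕ) → p < 4 * q → (N : ℕ) → ∃[ n ] (N ≤ n × p ^ n ≤ s r n * q ^ n))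
mainTheorem3 r = growth-rate≤4 r , growth-rate≥4 r
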